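{- Let $a=(a_0,a_1,\ldots)$, $b=(b_0,b_1,\ldots)\in\mathbf W(\mathbb F_2)$ and write, in $\mathbf W(\mathbb F_2)$, $a\dot+b=(c_0,c_1,\ldots)$, $\dot-a=(d_0,d_1,\ldots)$, $a\dot\times b=(e_0,e_1,\ldots)$. Then in $\mathbb F_2$: (i) $c_0=a_0+b_0$ and for $t\ge1$, $c_t=a_t+b_t+\sum_{i=0}^{t-1}a_ib_i\prod_{j=i+1}^{t-1}(a_j+b_j)$; (ii) $d_0=a_0$ and for $t\ge1$, $d_t=a_t+1+\prod_{i=0}^{t-1}(1+a_i)$; (iii) $e_0=a_0b_0$ and for $t\ge1$, $e_t=\sum_{(l_1,\ldots,l_t)\in\mathbf L_2(t)}\prod_{1\le k\le t}\tau_{l_k}(a_0b_k,a_1b_{k-1},\ldots,a_kb_0)$.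
   Context: $\mathbf W(\mathbb F_2)$ is the ring of ($2$-typical) Witt vectors with coefficients in $\mathbb F_2$, with Witt addition $\dot+$, negation $\dot-$ and multiplication $\dot\times$. $\mathbf L_2(t)=\{(l_1,\ldots,l_t)\in\mathbb Z_{\ge0}^t:\sum_{k=1}^t l_k2^k=2^t,\ 0\le l_k\le k+1\}$. $\tau_l(X_0,\ldots,X_m)$ denotes the $l$-th elementary symmetric polynomial in $X_0,\ldots,X_m$ ($\tau_0=1$). Empty products equal $1$. -}

module Defs where

open import Data.Bool using (Bool; true; false; _∧_; _xor_; if_then_else_)
open import Data.Nat as ℕ using (ℕ; zero; suc; _∸_; _≟_)
open import Data.Nat.Properties using (m^n≢0)
open import Data.Integer as ℤ using (ℤ; +_; _/ℕ_; _%ℕ_)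
open import Data.List using (List; []; _∷_; map; upTo; allFin; foldr; filter; concatMap; _∷ʳ_)
open import Data.Fin using (Fin; toℕ)
open import Data.Vec as Vec using (Vec; lookup)

-- The field 𝔽₂ is modelled by Bool: addition is _xor_, multiplication _∧_.

F2 : Set
F2 = Bool

W : Set
W = ℕ → F2

-- The Witt polynomials S_n (sum), I_n (negation), P_n (product) have
-- integer coefficients and are characterised by the ghost equations
--   Σ_{i≤n} 2^i S_i^{2^{n-i}} = w_n(X) + w_n(Y)     (resp. -w_n(X), w_n(X) w_n(Y)),
-- with w_n(X) = Σ_{i≤n} 2^i X_i^{2^{n-i}}.  The n-th coordinate of the
-- Witt sum of a, b ∈ W(𝔽₂) is S_n(ã, b̃) mod 2 for integer lifts ã, b̃.
-- Evaluating S_n at integer points is computed from the ghost equation: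
-- S_n(x) = (ghost_n - Σ_{i<n} 2^i S_i(x)^{2^{n-i}}) / 2^n  (division is exact).

-- lift of 𝔽₂ to ℤ (Teichmüller / standard representatives 0, 1)
lift : F2 → ℤ
lift true  = + 1
lift false = + 0

red : ℤ → F2
red z = (z %ℕ 2) ℕ.≡ᵇ 1

gs : ℕ → ℕ → List ℤ → ℤ
gs n i []       = + 0
gs n i (x ∷ xs) = (+ (2 ℕ.^ i)) ℤ.* (x ℤ.^ (2 ℕ.^ (n ∸ i))) ℤ.+ gs n (suc i) xs

ghost : (ℕ → ℤ) → ℕ → ℤ
ghost x n = gs n 0 (map x (upTo (suc n)))

nextCoord : (ℕ → ℤ) → (n : ℕ) → List ℤ → ℤ
nextCoord g n prev =
  _/ℕ_ (g n ℤ.- gs n 0 prev) (2 ℕ.^ n) {{m^n≢0 2 n}}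

prefix : (ℕ → ℤ) → ℕ → List ℤ
prefix g zero    = []
prefix g (suc n) = prefix g n ∷ʳ nextCoord g n (prefix g n)

fromGhost : (ℕ → ℤ) → ℕ → ℤ
fromGhost g n = nextCoord g n (prefix g n)

liftW : W → ℕ → ℤ
liftW a n = lift (a n)

_∔_ : W → W → W
(a ∔ b) n = red (fromGhost (λ m → ghost (liftW a) m ℤ.+ ghost (liftW b) m) n)

∸W_ : W → W
(∸W a) n = red (fromGhost (λ m → ℤ.- ghost (liftW a) m) n)

_⊛_ : W → W → W
(a ⊛ b) n = red (fromGhost (λ m → ghost (liftW a) m ℤ.* ghost (liftW b) m) n)

Σ< : ℕ → (ℕ → F2) → F2
Σ< zero    f = false
Σ< (suc n) f = Σ< n f xor f n

Π< : ℕ → (ℕ → F2) → F2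
Π< zero    f = true
Π< (suc n) f = Π< n f ∧ f n

-- Πrange lo hi f = Π_{lo ≤ j ≤ hi-1} f j  (empty if hi ≤ lo)
Πrange : ℕ → ℕ → (ℕ → F2) → F2
Πrange lo hi f = Π< (hi ∸ lo) (λ k → f (lo ℕ.+ k))

sumList : List F2 → F2
sumList = foldr _xor_ false

prodList : List F2 → F2
prodList = foldr _∧_ true

-- elementary symmetric polynomial τ_l(X_0, …, X_m) evaluated in 𝔽₂
-- (sum over l-element subsets, splitting on whether X_0 is included)
τ : ℕ → List F2 → F2
τ zero    xs       = true
τ (suc l) []       = false
τ (suc l) (x ∷ xs) = (x ∧ τ l xs) xor τ (suc l) xs

-- The index set L₂(t).  A tuple (l₁,…,l_t) is a Vec ℕ t whose position
-- i : Fin t holds l_{k} with k = toℕ i + 1.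

bounded : (t : ℕ) → List (Vec ℕ t)
bounded zero    = Vec.[] ∷ []
bounded (suc t) =
  concatMap (λ v → map (λ x → v Vec.∷ʳ x) (upTo (suc t ℕ.+ 2))) (bounded t)

weight : {t : ℕ} → Vec ℕ t → ℕ
weight {t} v = foldr ℕ._+_ 0 (map (λ i → lookup v i ℕ.* 2 ℕ.^ suc (toℕ i)) (allFin t))

L₂ : (t : ℕ) → List (Vec ℕ t)
L₂ t = filter (λ v → weight v ≟ 2 ℕ.^ t) (bounded t)

diagTerms : W → W → ℕ → List F2
diagTerms a b k = map (λ i → a i ∧ b (k ∸ i)) (upTo (suc k))

mulTerm : W → W → {t : ℕ} → Vec ℕ t → F2
mulTerm a b {t} v =
  prodList (map (λ i → τ (lookup v i) (diagTerms a b (suc (toℕ i)))) (allFin t))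

-- Identify W(𝔽₂) with the 2-adic integers, a ↦ Σ 2^i a_i. The n-th ghost component of the Teichmüller
-- lift of a is the binary numeral A_n = Σ_{i≤n} 2^i a_i, and conversely if the ghost components of an
-- integer vector are ≡ Σ_{i≤n} 2^i u_i modulo 2^(n+1), then its Witt coordinates are ≡ u_n modulo 2.
-- So the coordinates of a ∔ b, ∸W a and a ⊛ b are the binary digits of A + B, -A and A·B. For A + B
-- they come from carry propagation and for -A from the two's complement (not A) + 1. The digit t of A·B
-- is that of Σ_{k≤t} D_k 2^k with D_k = #{j ≤ k : a_j b_(k-j) = 1}. By Lucas' theorem it equals
-- C(Σ_k D_k 2^k, 2^t) mod 2, the coefficient of X^(2^t) in Π_k (1 + X^(2^k))^(D_k) over 𝔽₂, and
-- expanding each power through elementary symmetric polynomials of the 0/1 values a_j b_(k-j) gives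
-- the sum over L₂(t).

module Submission where

open import Defs
open import Algebra.Bundles using (CommutativeRing)
open import Algebra.Definitions using (Associative; Identity)
import Algebra.Properties.CommutativeSemigroup as CommutativeSemigroupProperties
open import Data.Bool using (true; false; not; _∧_; _xor_)
open import Data.Bool.Properties
  using ( xor-assoc; xor-comm; xor-identityʳ; xor-same; xor-∧-commutativeRing
        ; ∧-assoc; ∧-comm; ∧-zeroʳ; ∧-identityʳ; ∧-identity; ∧-distribʳ-xor)
open import Data.Empty using (⊥-elim)
open import Data.Fin using (Fin; toℕ; inject₁; fromℕ)
open import Data.Fin.Properties using (toℕ-inject₁; toℕ-fromℕ)
open import Data.List
  using (List; []; _∷_; _++_; map; foldr; length; applyUpTo; upTo; tabulate; allFin; filter; concatMap)
open import Data.List.Properties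
  using (foldr-++; map-++; map-cong; map-∘; map-tabulate; tabulate-cong; length-map; length-applyUpTo)
open import Data.Nat using (ℕ; NonZero; zero; suc; _+_; _*_; _∸_; _^_; _≤_; _<_; z≤n; s≤s; _≤?_; _≡ᵇ_; _≟_)
open import Data.Nat.Properties
open import Data.Nat.Tactic.RingSolver using (solve-∀)
open import Data.Product using (_×_; _,_; proj₁; proj₂; ∃; ∃₂)
open import Data.Vec as Vec using (Vec; lookup)
open import Function using (_∘_)
open import Relation.Binary.PropositionalEquality
open import Relation.Nullary using (Dec; yes; no; ¬_; does)

xor-interchange : ∀ w x y z → (w xor x) xor (y xor z) ≡ (w xor y) xor (x xor z)
xor-interchange = CommutativeSemigroupProperties.interchange
  (CommutativeRing.+-commutativeSemigroup xor-∧-commutativeRing)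

bitℕ : F2 → ℕ
bitℕ true  = 1
bitℕ false = 0

bitℕ-∧ : ∀ x y → bitℕ (x ∧ y) ≡ bitℕ x * bitℕ y
bitℕ-∧ true  y = sym (+-identityʳ (bitℕ y))
bitℕ-∧ false y = refl

∑< : ℕ → (ℕ → ℕ) → ℕ
∑< zero    f = 0
∑< (suc n) f = f 0 + ∑< n (f ∘ suc)

∑<-cong : ∀ n {f g} → (∀ i → i < n → f i ≡ g i) → ∑< n f ≡ ∑< n g
∑<-cong zero    e = refl
∑<-cong (suc n) e = cong₂ _+_ (e 0 (s≤s z≤n)) (∑<-cong n (λ i i<n → e (suc i) (s≤s i<n)))

∑<-snoc : ∀ n f → ∑< (suc n) f ≡ ∑< n f + f n
∑<-snoc zero    f = +-comm (f 0) 0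
∑<-snoc (suc n) f = trans (cong (f 0 +_) (∑<-snoc n (f ∘ suc))) (sym (+-assoc (f 0) _ _))

∑<-+ : ∀ n f g → ∑< n (λ i → f i + g i) ≡ ∑< n f + ∑< n g
∑<-+ zero    f g = refl
∑<-+ (suc n) f g = trans (cong (f 0 + g 0 +_) (∑<-+ n (f ∘ suc) (g ∘ suc)))
                         (interchange (f 0) (g 0) _ _)
  where
  interchange : ∀ a b c d → a + b + (c + d) ≡ a + c + (b + d)
  interchange = solve-∀

∑<-*ˡ : ∀ n c f → ∑< n (λ i → c * f i) ≡ c * ∑< n f
∑<-*ˡ zero    c f = sym (*-zeroʳ c)
∑<-*ˡ (suc n) c f = trans (cong (c * f 0 +_) (∑<-*ˡ n c (f ∘ suc))) (sym (*-distribˡ-+ c _ _))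

∑<-*ʳ : ∀ n f c → ∑< n f * c ≡ ∑< n (λ i → f i * c)
∑<-*ʳ zero    f c = refl
∑<-*ʳ (suc n) f c = trans (*-distribʳ-+ c (f 0) _) (cong (f 0 * c +_) (∑<-*ʳ n (f ∘ suc) c))

∑<-split : ∀ m k f → ∑< (m + k) f ≡ ∑< m f + ∑< k (λ j → f (m + j))
∑<-split zero    k f = refl
∑<-split (suc m) k f = trans (cong (f 0 +_) (∑<-split m k (f ∘ suc))) (sym (+-assoc (f 0) _ _))

Σ<-cong : ∀ n {f g} → (∀ i → i < n → f i ≡ g i) → Σ< n f ≡ Σ< n g
Σ<-cong zero    e = refl
Σ<-cong (suc n) e = cong₂ _xor_ (Σ<-cong n (λ i i<n → e i (≤-trans i<n (n≤1+n n)))) (e n ≤-refl)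

Σ<-∧ʳ : ∀ n f c → Σ< n (λ i → f i ∧ c) ≡ Σ< n f ∧ c
Σ<-∧ʳ zero    f c = refl
Σ<-∧ʳ (suc n) f c = trans (cong (_xor (f n ∧ c)) (Σ<-∧ʳ n f c)) (sym (∧-distribʳ-xor c (Σ< n f) (f n)))

Πrange-snoc : ∀ {i t} f → i ≤ t → Πrange (suc i) (suc (suc t)) f ≡ Πrange (suc i) (suc t) f ∧ f (suc t)
Πrange-snoc {i} {t} f i≤t = begin
  Π< (suc t ∸ i) g          ≡⟨ cong (λ k → Π< k g) (+-∸-assoc 1 i≤t) ⟩
  Π< (t ∸ i) g ∧ g (t ∸ i)  ≡⟨ cong (λ k → Π< (t ∸ i) g ∧ f (suc k)) (m+[n∸m]≡n i≤t) ⟩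
  Π< (t ∸ i) g ∧ f (suc t)  ∎
  where
  open ≡-Reasoning
  g : ℕ → F2
  g k = f (suc i + k)

Πrange-empty : ∀ t f → Πrange (suc t) (suc t) f ≡ true
Πrange-empty t f = cong (λ k → Π< k (λ j → f (suc t + j))) (n∸n≡0 t)

xorSum : ℕ → (ℕ → F2) → F2
xorSum zero    h = false
xorSum (suc N) h = h 0 xor xorSum N (h ∘ suc)

xorSum-cong : ∀ N {f g} → (∀ i → f i ≡ g i) → xorSum N f ≡ xorSum N g
xorSum-cong zero    e = refl
xorSum-cong (suc N) e = cong₂ _xor_ (e 0) (xorSum-cong N (e ∘ suc))

xorSum-false : ∀ N → xorSum N (λ _ → false) ≡ false
xorSum-false zero    = refl
xorSum-false (suc N) = xorSum-false N

xorSum-xor : ∀ N f g → xorSum N (λ i → f i xor g i) ≡ xorSum N f xor xorSum N g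
xorSum-xor zero    f g = refl
xorSum-xor (suc N) f g = trans (cong ((f 0 xor g 0) xor_) (xorSum-xor N (f ∘ suc) (g ∘ suc)))
                               (xor-interchange (f 0) (g 0) _ _)

xorSum-∧ˡ : ∀ N c f → xorSum N (λ i → c ∧ f i) ≡ c ∧ xorSum N f
xorSum-∧ˡ N true  f = refl
xorSum-∧ˡ N false f = xorSum-false N

sumList-map-applyUpTo : ∀ N (h : ℕ → F2) f → sumList (map h (applyUpTo f N)) ≡ xorSum N (h ∘ f)
sumList-map-applyUpTo zero    h f = refl
sumList-map-applyUpTo (suc N) h f = cong (h (f 0) xor_) (sumList-map-applyUpTo N h (f ∘ suc))

sumList-++ : ∀ xs ys → sumList (xs ++ ys) ≡ sumList xs xor sumList ys
sumList-++ xs ys = trans (foldr-++ _xor_ false xs ys) (foldr-xor xs)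
  where
  foldr-xor : ∀ xs → foldr _xor_ (sumList ys) xs ≡ sumList xs xor sumList ys
  foldr-xor []       = refl
  foldr-xor (x ∷ xs) = trans (cong (x xor_) (foldr-xor xs)) (sym (xor-assoc x _ _))

sumList-map-filter : ∀ {A : Set} {P : A → Set} (P? : ∀ v → Dec (P v)) (φ : A → F2) vs →
  sumList (map φ (filter P? vs)) ≡ sumList (map (λ v → does (P? v) ∧ φ v) vs)
sumList-map-filter P? φ []       = refl
sumList-map-filter P? φ (v ∷ vs) with does (P? v)
... | true  = cong (φ v xor_) (sumList-map-filter P? φ vs)
... | false = sumList-map-filter P? φ vs

sumList-map-concatMap : ∀ {A B : Set} (φ : B → F2) (F : A → List B) vs →
  sumList (map φ (concatMap F vs)) ≡ sumList (map (λ v → sumList (map φ (F v))) vs)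
sumList-map-concatMap φ F []       = refl
sumList-map-concatMap φ F (v ∷ vs) = begin
  sumList (map φ (F v ++ concatMap F vs))                   ≡⟨ cong sumList (map-++ φ (F v) _) ⟩
  sumList (map φ (F v) ++ map φ (concatMap F vs))           ≡⟨ sumList-++ (map φ (F v)) _ ⟩
  sumList (map φ (F v)) xor sumList (map φ (concatMap F vs))
    ≡⟨ cong (sumList (map φ (F v)) xor_) (sumList-map-concatMap φ F vs) ⟩
  sumList (map (λ v → sumList (map φ (F v))) (v ∷ vs))     ∎
  where open ≡-Reasoning

sumList-map-xorSum : ∀ {A : Set} N (h : A → ℕ → F2) vs →
  sumList (map (λ v → xorSum N (h v)) vs) ≡ xorSum N (λ x → sumList (map (λ v → h v x) vs))
sumList-map-xorSum N h []       = sym (xorSum-false N)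
sumList-map-xorSum N h (v ∷ vs) = trans (cong (xorSum N (h v) xor_) (sumList-map-xorSum N h vs))
                                        (sym (xorSum-xor N (h v) _))

sumList-map-∧ʳ : ∀ {A : Set} (f : A → F2) c vs → sumList (map (λ v → f v ∧ c) vs) ≡ sumList (map f vs) ∧ c
sumList-map-∧ʳ f c []       = refl
sumList-map-∧ʳ f c (v ∷ vs) =
  trans (cong ((f v ∧ c) xor_) (sumList-map-∧ʳ f c vs)) (sym (∧-distribʳ-xor c (f v) _))

module _ {B : Set} (_∙_ : B → B → B) (ε : B)
         (∙-assoc : Associative _≡_ _∙_) (∙-identity : Identity _≡_ ε _∙_) where

  foldr-tabulate-last : ∀ t (g : Fin (suc t) → B) →
    foldr _∙_ ε (tabulate g) ≡ foldr _∙_ ε (tabulate (g ∘ inject₁)) ∙ g (fromℕ t)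
  foldr-tabulate-last zero    g = trans (proj₂ ∙-identity (g Fin.zero)) (sym (proj₁ ∙-identity (g Fin.zero)))
  foldr-tabulate-last (suc t) g =
    trans (cong (g Fin.zero ∙_) (foldr-tabulate-last t (g ∘ Fin.suc))) (sym (∙-assoc (g Fin.zero) _ _))

  foldr-allFin-∷ʳ : ∀ {A : Set} t (h : A → ℕ → B) (v : Vec A t) x →
    foldr _∙_ ε (map (λ i → h (lookup (v Vec.∷ʳ x) i) (toℕ i)) (allFin (suc t)))
      ≡ foldr _∙_ ε (map (λ i → h (lookup v i) (toℕ i)) (allFin t)) ∙ h x t
  foldr-allFin-∷ʳ t h v x = begin
    foldr _∙_ ε (map g (allFin (suc t)))
      ≡⟨ cong (foldr _∙_ ε) (map-tabulate (λ i → i) g) ⟩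
    foldr _∙_ ε (tabulate g)                                          ≡⟨ foldr-tabulate-last t g ⟩
    foldr _∙_ ε (tabulate (g ∘ inject₁)) ∙ g (fromℕ t)
      ≡⟨ cong₂ _∙_ (cong (foldr _∙_ ε) (trans (tabulate-cong (λ i → cong₂ h (lookup-inject₁ v i) (toℕ-inject₁ i)))
                                               (sym (map-tabulate (λ i → i) (λ i → h (lookup v i) (toℕ i))))))
                   (cong₂ h (lookup-last v) (toℕ-fromℕ t)) ⟩
    foldr _∙_ ε (map (λ i → h (lookup v i) (toℕ i)) (allFin t)) ∙ h x t ∎
    where
    open ≡-Reasoning
    g : Fin (suc t) → B
    g i = h (lookup (v Vec.∷ʳ x) i) (toℕ i)
    lookup-inject₁ : ∀ {n} (u : Vec _ n) (i : Fin n) → lookup (u Vec.∷ʳ x) (inject₁ i) ≡ lookup u i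
    lookup-inject₁ (y Vec.∷ u) Fin.zero    = refl
    lookup-inject₁ (y Vec.∷ u) (Fin.suc i) = lookup-inject₁ u i
    lookup-last : ∀ {n} (u : Vec _ n) → lookup (u Vec.∷ʳ x) (fromℕ n) ≡ x
    lookup-last Vec.[]      = refl
    lookup-last (y Vec.∷ u) = lookup-last u

fromDigits : W → ℕ → ℕ
fromDigits u n = ∑< (suc n) (λ j → 2 ^ j * bitℕ (u j))

fromDigits-suc : ∀ u n → fromDigits u (suc n) ≡ fromDigits u n + 2 ^ suc n * bitℕ (u (suc n))
fromDigits-suc u n = ∑<-snoc (suc n) (λ j → 2 ^ j * bitℕ (u j))

digitsAbove : W → ℕ → ℕ → ℕ
digitsAbove u m n = ∑< (n ∸ m) (λ j → 2 ^ j * bitℕ (u (suc m + j)))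

2^*2^[suc-∸]≡2^suc : ∀ {j i} → j ≤ i → 2 ^ j * 2 ^ suc (i ∸ j) ≡ 2 ^ suc i
2^*2^[suc-∸]≡2^suc {j} {i} j≤i = begin
  2 ^ j * 2 ^ suc (i ∸ j) ≡⟨ ^-distribˡ-+-* 2 j (suc (i ∸ j)) ⟨
  2 ^ (j + suc (i ∸ j))   ≡⟨ cong (2 ^_) (+-suc j (i ∸ j)) ⟩
  2 ^ suc (j + (i ∸ j))   ≡⟨ cong (λ k → 2 ^ suc k) (m+[n∸m]≡n j≤i) ⟩
  2 ^ suc i               ∎
  where open ≡-Reasoning

fromDigits-split : ∀ u {m n} → m ≤ n → fromDigits u n ≡ fromDigits u m + 2 ^ suc m * digitsAbove u m n
fromDigits-split u {m} {n} m≤n = begin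
  ∑< (suc n) f                                  ≡⟨ cong (λ k → ∑< (suc k) f) (m+[n∸m]≡n m≤n) ⟨
  ∑< (suc m + (n ∸ m)) f                        ≡⟨ ∑<-split (suc m) (n ∸ m) f ⟩
  fromDigits u m + ∑< (n ∸ m) (λ j → f (suc m + j))
    ≡⟨ cong (fromDigits u m +_) (trans (∑<-cong (n ∸ m) (λ j _ → shiftTerm j)) (∑<-*ˡ (n ∸ m) (2 ^ suc m) _)) ⟩
  fromDigits u m + 2 ^ suc m * digitsAbove u m n ∎
  where
  open ≡-Reasoning
  f : ℕ → ℕ
  f j = 2 ^ j * bitℕ (u j)
  shiftTerm : ∀ j → f (suc m + j) ≡ 2 ^ suc m * (2 ^ j * bitℕ (u (suc m + j)))
  shiftTerm j = trans (cong (_* bitℕ (u (suc m + j))) (^-distribˡ-+-* 2 (suc m) j))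
                      (*-assoc (2 ^ suc m) (2 ^ j) _)

bitsValue : List F2 → ℕ
bitsValue []       = 0
bitsValue (b ∷ bs) = bitℕ b + 2 * bitsValue bs

bitsValue-map-applyUpTo : ∀ (u : W) f k → bitsValue (map u (applyUpTo f k)) ≡ ∑< k (λ j → 2 ^ j * bitℕ (u (f j)))
bitsValue-map-applyUpTo u f zero    = refl
bitsValue-map-applyUpTo u f (suc k) = cong₂ _+_ (sym (*-identityˡ (bitℕ (u (f 0)))))
  (trans (cong (2 *_) (bitsValue-map-applyUpTo u (f ∘ suc) k))
         (trans (sym (∑<-*ˡ k 2 (λ j → 2 ^ j * bitℕ (u (f (suc j))))))
                (∑<-cong k (λ j _ → sym (*-assoc 2 (2 ^ j) _)))))

-- Polynomials over 𝔽₂, as coefficient sequences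

Poly : Set
Poly = ℕ → F2

one : Poly
one w = w ≡ᵇ 0

shift : ℕ → Poly → Poly
shift m f w with m ≤? w
... | yes _ = f (w ∸ m)
... | no  _ = false

shift-≤ : ∀ {m w} f → m ≤ w → shift m f w ≡ f (w ∸ m)
shift-≤ {m} {w} f m≤w with m ≤? w
... | yes _   = refl
... | no  m≰w = ⊥-elim (m≰w m≤w)

shift-≰ : ∀ {m w} f → ¬ m ≤ w → shift m f w ≡ false
shift-≰ {m} {w} f m≰w with m ≤? w
... | yes m≤w = ⊥-elim (m≰w m≤w)
... | no  _   = refl

shift-cong : ∀ m {f g} → (∀ v → f v ≡ g v) → ∀ w → shift m f w ≡ shift m g w
shift-cong m e w with m ≤? w
... | yes _ = e (w ∸ m)
... | no  _ = refl

shift-zero : ∀ f w → shift 0 f w ≡ f w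
shift-zero f w = shift-≤ f z≤n

shift-∧ˡ : ∀ m c f w → shift m (λ v → c ∧ f v) w ≡ c ∧ shift m f w
shift-∧ˡ m c f w with m ≤? w
... | yes _ = refl
... | no  _ = sym (∧-zeroʳ c)

shift-∧ʳ : ∀ m f c w → shift m (λ v → f v ∧ c) w ≡ shift m f w ∧ c
shift-∧ʳ m f c w with m ≤? w
... | yes _ = refl
... | no  _ = refl

shift-shift : ∀ m n f w → shift m (shift n f) w ≡ shift (m + n) f w
shift-shift m n f w with m ≤? w
... | no m≰w = sym (shift-≰ f (λ m+n≤w → m≰w (≤-trans (m≤m+n m n) m+n≤w)))
... | yes m≤w with n ≤? w ∸ m
...   | yes n≤w∸m = trans (cong f (∸-+-assoc w m n))
                          (sym (shift-≤ f (subst (_≤ w) (+-comm n m) (m≤o∸n⇒m+n≤o n m≤w n≤w∸m))))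
...   | no  n≰w∸m = sym (shift-≰ f (λ m+n≤w → n≰w∸m (m+n≤o⇒m≤o∸n n (subst (_≤ w) (+-comm m n) m+n≤w))))

shift-xorSum : ∀ m N (k : ℕ → Poly) w → shift m (λ v → xorSum N (λ i → k i v)) w ≡ xorSum N (λ i → shift m (k i) w)
shift-xorSum m N k w with m ≤? w
... | yes _ = refl
... | no  _ = sym (xorSum-false N)

shift-sumList : ∀ {A : Set} m (k : A → Poly) vs w →
  shift m (λ v → sumList (map (λ x → k x v) vs)) w ≡ sumList (map (λ x → shift m (k x) w) vs)
shift-sumList m k vs w with m ≤? w
... | yes _ = refl
... | no  _ = sym (all-false vs)
  where
  all-false : ∀ vs → sumList (map (λ _ → false) vs) ≡ false
  all-false []       = refl
  all-false (_ ∷ vs) = all-false vs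

monomial : ℕ → Poly
monomial p w = does (p ≟ w)

monomial-+ : ∀ p m w → monomial (p + m) w ≡ shift m (monomial p) w
monomial-+ p m w with m ≤? w
... | yes m≤w = agree (p + m ≟ w) (p ≟ w ∸ m)
  where
  agree : (d : Dec (p + m ≡ w)) (d′ : Dec (p ≡ w ∸ m)) → does d ≡ does d′
  agree (yes _)      (yes _)      = refl
  agree (no  _)      (no  _)      = refl
  agree (yes p+m≡w)  (no  p≢w∸m)  = ⊥-elim (p≢w∸m (trans (sym (m+n∸n≡m p m)) (cong (_∸ m) p+m≡w)))
  agree (no  p+m≢w)  (yes p≡w∸m)  = ⊥-elim (p+m≢w (trans (cong (_+ m) p≡w∸m) (m∸n+n≡m m≤w)))
... | no m≰w = absent (p + m ≟ w)
  where
  absent : (d : Dec (p + m ≡ w)) → does d ≡ false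
  absent (yes p+m≡w) = ⊥-elim (m≰w (subst (m ≤_) p+m≡w (m≤n+m m p)))
  absent (no  _)     = refl

mulBinom : ℕ → F2 → Poly → Poly
mulBinom m c f w = f w xor (c ∧ shift m f w)

mulBinom-cong : ∀ m c {f g} → (∀ v → f v ≡ g v) → ∀ w → mulBinom m c f w ≡ mulBinom m c g w
mulBinom-cong m c e w = cong₂ (λ x y → x xor (c ∧ y)) (e w) (shift-cong m e w)

-- Frobenius: (1 + X ^ m) ^ 2 = 1 + X ^ (m + m) over 𝔽₂
mulBinom-square : ∀ m f w → mulBinom m true (mulBinom m true f) w ≡ mulBinom (m + m) true f w
mulBinom-square m f w = by-cases (m ≤? w)
  where
  open ≡-Reasoning
  v = w ∸ m
  by-cases : Dec (m ≤ w) → mulBinom m true (mulBinom m true f) w ≡ mulBinom (m + m) true f w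
  by-cases (no m≰w) = begin
    (f w xor shift m f w) xor shift m (mulBinom m true f) w
      ≡⟨ cong₂ (λ x y → (f w xor x) xor y) (shift-≰ f m≰w) (shift-≰ _ m≰w) ⟩
    (f w xor false) xor false   ≡⟨ xor-identityʳ _ ⟩
    f w xor false               ≡⟨ cong (f w xor_) (shift-≰ f (λ 2m≤w → m≰w (≤-trans (m≤m+n m m) 2m≤w))) ⟨
    f w xor shift (m + m) f w   ∎
  by-cases (yes m≤w) = begin
    (f w xor shift m f w) xor shift m (mulBinom m true f) w
      ≡⟨ cong₂ (λ x y → (f w xor x) xor y) (shift-≤ f m≤w) (shift-≤ _ m≤w) ⟩
    (f w xor f v) xor (f v xor shift m f v)  ≡⟨ xor-assoc (f w) (f v) _ ⟩
    f w xor (f v xor (f v xor shift m f v))  ≡⟨ cong (f w xor_) (xor-assoc (f v) (f v) _) ⟨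
    f w xor ((f v xor f v) xor shift m f v)  ≡⟨ cong (λ x → f w xor (x xor shift m f v)) (xor-same (f v)) ⟩
    f w xor shift m f v                      ≡⟨ cong (f w xor_) (shift-≤ (shift m f) m≤w) ⟨
    f w xor shift m (shift m f) w            ≡⟨ cong (f w xor_) (shift-shift m m f w) ⟩
    f w xor shift (m + m) f w                ∎

-- (1 + X) ^ M, whose coefficients are the binomial coefficients mod 2
binom₂ : ℕ → Poly
binom₂ zero    = one
binom₂ (suc M) = mulBinom 1 true (binom₂ M)

mulBinom-binom₂ : ∀ s {f} M → (∀ v → f v ≡ binom₂ M v) → ∀ w → mulBinom (2 ^ s) true f w ≡ binom₂ (2 ^ s + M) w
mulBinom-binom₂ zero    M f≗ w = mulBinom-cong 1 true f≗ w
mulBinom-binom₂ (suc s) {f} M f≗ w = begin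
  mulBinom (2 ^ suc s) true f w
    ≡⟨ cong (λ k → mulBinom (2 ^ s + k) true f w) (+-identityʳ (2 ^ s)) ⟩
  mulBinom (2 ^ s + 2 ^ s) true f w                       ≡⟨ mulBinom-square (2 ^ s) f w ⟨
  mulBinom (2 ^ s) true (mulBinom (2 ^ s) true f) w
    ≡⟨ mulBinom-binom₂ s (2 ^ s + M) (mulBinom-binom₂ s M f≗) w ⟩
  binom₂ (2 ^ s + (2 ^ s + M)) w                          ≡⟨ cong (λ k → binom₂ k w) (+-assoc (2 ^ s) (2 ^ s) M) ⟨
  binom₂ (2 ^ s + 2 ^ s + M) w
    ≡⟨ cong (λ k → binom₂ (2 ^ s + k + M) w) (+-identityʳ (2 ^ s)) ⟨
  binom₂ (2 ^ suc s + M) w                                ∎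
  where open ≡-Reasoning

-- (s , c) stands for the factor 1 + c X ^ (2 ^ s)
prodBinom : List (ℕ × F2) → Poly
prodBinom []            = one
prodBinom ((s , c) ∷ r) = mulBinom (2 ^ s) c (prodBinom r)

exponent : List (ℕ × F2) → ℕ
exponent []            = 0
exponent ((s , c) ∷ r) = bitℕ c * 2 ^ s + exponent r

prodBinom≡binom₂ : ∀ l w → prodBinom l w ≡ binom₂ (exponent l) w
prodBinom≡binom₂ []                w = refl
prodBinom≡binom₂ ((s , false) ∷ r) w = trans (xor-identityʳ (prodBinom r w)) (prodBinom≡binom₂ r w)
prodBinom≡binom₂ ((s , true)  ∷ r) w =
  trans (mulBinom-binom₂ s (exponent r) (prodBinom≡binom₂ r) w)
        (cong (λ k → binom₂ (k + exponent r) w) (sym (*-identityˡ (2 ^ s))))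

column : ℕ → List F2 → List (ℕ × F2)
column s cs = map (s ,_) cs

-- Π_{c ∈ cs} (1 + c Y) = Σ_{x<N} τ_x(cs) Y ^ x with Y = X ^ (2 ^ s); the terms with x > |cs| vanish
prodBinom-column : ∀ s cs r N → length cs < N → ∀ w →
  prodBinom (column s cs ++ r) w ≡ xorSum N (λ x → τ x cs ∧ shift (x * 2 ^ s) (prodBinom r) w)
prodBinom-column s []       r (suc N) _ w =
  sym (trans (cong₂ _xor_ (shift-zero (prodBinom r) w) (xorSum-false N)) (xor-identityʳ (prodBinom r w)))
prodBinom-column s (c ∷ cs) r (suc N) (s≤s |cs|<N) w = begin
  prodBinom (column s cs ++ r) w xor (c ∧ shift (2 ^ s) (prodBinom (column s cs ++ r)) w)
    ≡⟨ cong₂ (λ x y → x xor (c ∧ y)) (prodBinom-column s cs r (suc N) (≤-trans |cs|<N (n≤1+n N)) w) shifted ⟩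
  (H 0 xor xorSum N (λ y → τ (suc y) cs ∧ H (suc y))) xor (c ∧ xorSum N (λ y → τ y cs ∧ H (suc y)))
    ≡⟨ xor-assoc (H 0) _ _ ⟩
  H 0 xor (xorSum N (λ y → τ (suc y) cs ∧ H (suc y)) xor (c ∧ xorSum N (λ y → τ y cs ∧ H (suc y))))
    ≡⟨ cong (H 0 xor_) (xor-comm (xorSum N (λ y → τ (suc y) cs ∧ H (suc y))) _) ⟩
  H 0 xor ((c ∧ xorSum N (λ y → τ y cs ∧ H (suc y))) xor xorSum N (λ y → τ (suc y) cs ∧ H (suc y)))
    ≡⟨ cong (λ z → H 0 xor (z xor xorSum N (λ y → τ (suc y) cs ∧ H (suc y)))) (xorSum-∧ˡ N c _) ⟨
  H 0 xor (xorSum N (λ y → c ∧ (τ y cs ∧ H (suc y))) xor xorSum N (λ y → τ (suc y) cs ∧ H (suc y)))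
    ≡⟨ cong (H 0 xor_) (xorSum-xor N _ _) ⟨
  H 0 xor xorSum N (λ y → (c ∧ (τ y cs ∧ H (suc y))) xor (τ (suc y) cs ∧ H (suc y)))
    ≡⟨ cong (H 0 xor_) (xorSum-cong N (λ y → regroup (τ y cs) (τ (suc y) cs) (H (suc y)))) ⟩
  H 0 xor xorSum N (λ y → τ (suc y) (c ∷ cs) ∧ H (suc y)) ∎
  where
  open ≡-Reasoning
  H : ℕ → F2
  H x = shift (x * 2 ^ s) (prodBinom r) w
  regroup : ∀ t t′ h → (c ∧ (t ∧ h)) xor (t′ ∧ h) ≡ ((c ∧ t) xor t′) ∧ h
  regroup t t′ h = trans (cong (_xor (t′ ∧ h)) (sym (∧-assoc c t h))) (sym (∧-distribʳ-xor h (c ∧ t) t′))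
  shifted : shift (2 ^ s) (prodBinom (column s cs ++ r)) w ≡ xorSum N (λ y → τ y cs ∧ H (suc y))
  shifted = begin
    shift (2 ^ s) (prodBinom (column s cs ++ r)) w
      ≡⟨ shift-cong (2 ^ s) (prodBinom-column s cs r N |cs|<N) w ⟩
    shift (2 ^ s) (λ v → xorSum N (λ x → τ x cs ∧ shift (x * 2 ^ s) (prodBinom r) v)) w
      ≡⟨ shift-xorSum (2 ^ s) N (λ x v → τ x cs ∧ shift (x * 2 ^ s) (prodBinom r) v) w ⟩
    xorSum N (λ x → shift (2 ^ s) (λ v → τ x cs ∧ shift (x * 2 ^ s) (prodBinom r) v) w)
      ≡⟨ xorSum-cong N (λ x → trans (shift-∧ˡ (2 ^ s) (τ x cs) _ w)
                                    (cong (τ x cs ∧_) (shift-shift (2 ^ s) (x * 2 ^ s) (prodBinom r) w))) ⟩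
    xorSum N (λ y → τ y cs ∧ H (suc y)) ∎

_≈_∘X² : Poly → Poly → Set
f ≈ g ∘X² = (∀ v → f (2 * v) ≡ g v) × (∀ v → f (suc (2 * v)) ≡ false)

∘X²-respˡ : ∀ {f f′ g} → (∀ w → f′ w ≡ f w) → f ≈ g ∘X² → f′ ≈ g ∘X²
∘X²-respˡ f′≗f (even , odd) = (λ v → trans (f′≗f (2 * v)) (even v)) , (λ v → trans (f′≗f _) (odd v))

one≈one∘X² : one ≈ one ∘X²
one≈one∘X² = even , λ v → refl
  where
  even : ∀ v → one (2 * v) ≡ one v
  even zero    = refl
  even (suc v) = cong one (*-suc 2 v)

2m≤2w⇒m≤w : ∀ {m w} → 2 * m ≤ suc (2 * w) → m ≤ w
2m≤2w⇒m≤w {m} {w} 2m≤1+2w with m ≤? w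
... | yes m≤w = m≤w
... | no  m≰w = ⊥-elim (<⇒≱ (subst (_≤ 2 * m) (*-suc 2 w) (*-monoʳ-≤ 2 (≰⇒> m≰w))) 2m≤1+2w)

shift-∘X² : ∀ {f g} m → f ≈ g ∘X² → shift (2 * m) f ≈ shift m g ∘X²
shift-∘X² {f} {g} m (even , odd) = shift-even , shift-odd
  where
  shift-even : ∀ w → shift (2 * m) f (2 * w) ≡ shift m g w
  shift-even w with m ≤? w
  ... | yes m≤w = trans (shift-≤ f (*-monoʳ-≤ 2 {m} {w} m≤w))
                        (trans (cong f (sym (*-distribˡ-∸ 2 w m))) (even (w ∸ m)))
  ... | no  m≰w = shift-≰ f (λ 2m≤2w → m≰w (*-cancelˡ-≤ {m} {w} 2 2m≤2w))
  shift-odd : ∀ w → shift (2 * m) f (suc (2 * w)) ≡ false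
  shift-odd w with 2 * m ≤? suc (2 * w)
  ... | no  _       = refl
  ... | yes 2m≤1+2w =
    trans (cong f (trans (+-∸-assoc 1 (*-monoʳ-≤ 2 {m} {w} m≤w)) (cong suc (sym (*-distribˡ-∸ 2 w m)))))
                            (odd (w ∸ m))
    where m≤w = 2m≤2w⇒m≤w 2m≤1+2w

mulBinom-∘X² : ∀ {f g} m c → f ≈ g ∘X² → mulBinom (2 * m) c f ≈ mulBinom m c g ∘X²
mulBinom-∘X² {f} m c f≈g = (λ w → cong₂ (λ x y → x xor (c ∧ y)) (proj₁ f≈g w) (proj₁ shift≈ w))
                         , (λ w → trans (cong₂ (λ x y → x xor (c ∧ y)) (proj₂ f≈g w) (proj₂ shift≈ w))
                                        (cong (false xor_) (∧-zeroʳ c)))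
  where shift≈ = shift-∘X² m f≈g

binom₂-double : ∀ Y → binom₂ (2 * Y) ≈ binom₂ Y ∘X²
binom₂-double zero    = one≈one∘X²
binom₂-double (suc Y) = subst (λ k → binom₂ k ≈ binom₂ (suc Y) ∘X²) (sym (*-suc 2 Y))
  (∘X²-respˡ (mulBinom-square 1 (binom₂ (2 * Y))) (mulBinom-∘X² {binom₂ (2 * Y)} 1 true (binom₂-double Y)))

binom₂-zero : ∀ M → binom₂ M 0 ≡ true
binom₂-zero zero    = refl
binom₂-zero (suc M) = trans (xor-identityʳ (binom₂ M 0)) (binom₂-zero M)

parity-split : ∀ M → ∃₂ λ b Y → M ≡ bitℕ b + 2 * Y
parity-split zero          = false , 0 , refl
parity-split (suc zero)    = true , 0 , refl
parity-split (suc (suc M)) with parity-split M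
... | b , Y , refl = b , suc Y , trans (+-suc-suc b) (cong (bitℕ b +_) (sym (*-suc 2 Y)))
  where
  +-suc-suc : ∀ b → suc (suc (bitℕ b + 2 * Y)) ≡ bitℕ b + suc (suc (2 * Y))
  +-suc-suc false = refl
  +-suc-suc true  = refl

-- By Lucas' theorem, C(M, 2 ^ i) mod 2 is the i-th binary digit of M.
digit : ℕ → ℕ → F2
digit M i = binom₂ M (2 ^ i)

digit-zero : ∀ b Y → digit (bitℕ b + 2 * Y) 0 ≡ b
digit-zero false Y = proj₂ (binom₂-double Y) 0
digit-zero true  Y = trans (cong₂ _xor_ (proj₂ (binom₂-double Y) 0) (shift-≤ {1} {1} (binom₂ (2 * Y)) (s≤s z≤n)))
                           (binom₂-zero (2 * Y))

digit-suc : ∀ b Y i → digit (bitℕ b + 2 * Y) (suc i) ≡ digit Y i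
digit-suc false Y i = proj₁ (binom₂-double Y) (2 ^ i)
digit-suc true  Y i = begin
  binom₂ (2 * Y) (2 * p) xor shift 1 (binom₂ (2 * Y)) (2 * p)
    ≡⟨ cong₂ _xor_ (proj₁ (binom₂-double Y) p) (shift-≤ (binom₂ (2 * Y)) (≤-trans 1≤p (m≤m+n p _))) ⟩
  binom₂ Y p xor binom₂ (2 * Y) (2 * p ∸ 1)
    ≡⟨ cong (λ k → binom₂ Y p xor binom₂ (2 * Y) k) 2p∸1≡1+2[p∸1] ⟩
  binom₂ Y p xor binom₂ (2 * Y) (suc (2 * (p ∸ 1)))
    ≡⟨ cong (binom₂ Y p xor_) (proj₂ (binom₂-double Y) (p ∸ 1)) ⟩
  binom₂ Y p xor false ≡⟨ xor-identityʳ _ ⟩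
  binom₂ Y p ∎
  where
  open ≡-Reasoning
  p = 2 ^ i
  1≤p : 1 ≤ p
  1≤p = m^n>0 2 i
  2p∸1≡1+2[p∸1] : 2 * p ∸ 1 ≡ suc (2 * (p ∸ 1))
  2p∸1≡1+2[p∸1] = begin
    2 * p ∸ 1             ≡⟨ cong (λ k → 2 * k ∸ 1) (m+[n∸m]≡n 1≤p) ⟨
    2 * (1 + (p ∸ 1)) ∸ 1 ≡⟨ cong (_∸ 1) (*-suc 2 (p ∸ 1)) ⟩
    suc (2 * (p ∸ 1))     ∎

digit-+2^suc* : ∀ i X K → digit (X + 2 ^ suc i * K) i ≡ digit X i
digit-+2^suc* zero X K with parity-split X
... | b , Y , refl = begin
  digit (bitℕ b + 2 * Y + 2 * K) 0
    ≡⟨ cong (λ k → digit k 0) (trans (+-assoc (bitℕ b) _ _) (cong (bitℕ b +_) (sym (*-distribˡ-+ 2 Y K)))) ⟩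
  digit (bitℕ b + 2 * (Y + K)) 0     ≡⟨ digit-zero b (Y + K) ⟩
  b                                  ≡⟨ digit-zero b Y ⟨
  digit (bitℕ b + 2 * Y) 0           ∎
  where open ≡-Reasoning
digit-+2^suc* (suc i) X K with parity-split X
... | b , Y , refl = begin
  digit (bitℕ b + 2 * Y + 2 ^ suc (suc i) * K) (suc i)
    ≡⟨ cong (λ k → digit k (suc i)) (regroup (bitℕ b) Y (2 ^ suc i) K) ⟩
  digit (bitℕ b + 2 * (Y + 2 ^ suc i * K)) (suc i) ≡⟨ digit-suc b (Y + 2 ^ suc i * K) i ⟩
  digit (Y + 2 ^ suc i * K) i                      ≡⟨ digit-+2^suc* i Y K ⟩
  digit Y i                                        ≡⟨ digit-suc b Y i ⟨
  digit (bitℕ b + 2 * Y) (suc i)                   ∎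
  where
  open ≡-Reasoning
  regroup : ∀ x y p k → x + 2 * y + 2 * p * k ≡ x + 2 * (y + p * k)
  regroup = solve-∀

fromDigits-digit-suc : ∀ b Y n → fromDigits (digit (bitℕ b + 2 * Y)) (suc n) ≡ bitℕ b + 2 * fromDigits (digit Y) n
fromDigits-digit-suc b Y n = cong₂ _+_ lowest higher
  where
  lowest : 1 * bitℕ (digit (bitℕ b + 2 * Y) 0) ≡ bitℕ b
  lowest = trans (*-identityˡ _) (cong bitℕ (digit-zero b Y))
  higher : ∑< (suc n) (λ j → 2 ^ suc j * bitℕ (digit (bitℕ b + 2 * Y) (suc j))) ≡ 2 * fromDigits (digit Y) n
  higher = trans (∑<-cong (suc n) (λ j _ → trans (cong (λ x → 2 ^ suc j * bitℕ x) (digit-suc b Y j))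
                                                 (*-assoc 2 (2 ^ j) _)))
                 (∑<-*ˡ (suc n) 2 (λ j → 2 ^ j * bitℕ (digit Y j)))

binaryExpansion : ∀ n M → ∃ λ q → M ≡ fromDigits (digit M) n + 2 ^ suc n * q
binaryExpansion zero M with parity-split M
... | b , Y , refl =
  Y , cong (_+ 2 * Y) (sym (trans (+-identityʳ _) (trans (+-identityʳ _) (cong bitℕ (digit-zero b Y)))))
binaryExpansion (suc n) M with parity-split M
... | b , Y , refl with binaryExpansion n Y
...   | q , Y≡ = q , (begin
  bitℕ b + 2 * Y                                           ≡⟨ cong (λ y → bitℕ b + 2 * y) Y≡ ⟩
  bitℕ b + 2 * (fromDigits (digit Y) n + 2 ^ suc n * q)
    ≡⟨ regroup (bitℕ b) (fromDigits (digit Y) n) (2 ^ suc n) q ⟩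
  (bitℕ b + 2 * fromDigits (digit Y) n) + 2 * 2 ^ suc n * q
    ≡⟨ cong (_+ 2 ^ suc (suc n) * q) (fromDigits-digit-suc b Y n) ⟨
  fromDigits (digit (bitℕ b + 2 * Y)) (suc n) + 2 ^ suc (suc n) * q ∎)
  where
  open ≡-Reasoning
  regroup : ∀ x y p k → x + 2 * (y + p * k) ≡ (x + 2 * y) + 2 * p * k
  regroup = solve-∀

weight-∷ʳ : ∀ t (v : Vec ℕ t) x → weight (v Vec.∷ʳ x) ≡ weight v + x * 2 ^ suc t
weight-∷ʳ t = foldr-allFin-∷ʳ _+_ 0 +-assoc +-identity t (λ l k → l * 2 ^ suc k)

mulTerm-∷ʳ : ∀ a b t (v : Vec ℕ t) x → mulTerm a b (v Vec.∷ʳ x) ≡ mulTerm a b v ∧ τ x (diagTerms a b (suc t))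
mulTerm-∷ʳ a b t = foldr-allFin-∷ʳ _∧_ true ∧-assoc ∧-identity t (λ l k → τ l (diagTerms a b (suc k)))

weightPoly : W → W → (t : ℕ) → Poly
weightPoly a b t w = sumList (map (λ v → monomial (weight v) w ∧ mulTerm a b v) (bounded t))

L₂-sum≡weightPoly : ∀ a b t → sumList (map (mulTerm a b) (L₂ t)) ≡ weightPoly a b t (2 ^ t)
L₂-sum≡weightPoly a b t = sumList-map-filter (λ v → weight v ≟ 2 ^ t) (mulTerm a b) (bounded t)

weightPoly-suc : ∀ a b t w → weightPoly a b (suc t) w ≡
  xorSum (suc t + 2) (λ x → τ x (diagTerms a b (suc t)) ∧ shift (x * 2 ^ suc t) (weightPoly a b t) w)
weightPoly-suc a b t w = begin
  sumList (map φ (concatMap extend (bounded t)))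
    ≡⟨ sumList-map-concatMap φ extend (bounded t) ⟩
  sumList (map (λ v → sumList (map φ (extend v))) (bounded t))
    ≡⟨ cong sumList (map-cong extensions (bounded t)) ⟩
  sumList (map (λ v → xorSum N (λ x → φ (v Vec.∷ʳ x))) (bounded t))
    ≡⟨ sumList-map-xorSum N (λ v x → φ (v Vec.∷ʳ x)) (bounded t) ⟩
  xorSum N (λ x → sumList (map (λ v → φ (v Vec.∷ʳ x)) (bounded t)))   ≡⟨ xorSum-cong N lastEntry ⟩
  xorSum N (λ x → τ x diag ∧ shift (x * 2 ^ suc t) (weightPoly a b t) w) ∎
  where
  open ≡-Reasoning
  N = suc t + 2
  diag = diagTerms a b (suc t)
  φ : Vec ℕ (suc t) → F2
  φ u = monomial (weight u) w ∧ mulTerm a b u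
  extend : Vec ℕ t → List (Vec ℕ (suc t))
  extend v = map (v Vec.∷ʳ_) (upTo N)
  extensions : ∀ v → sumList (map φ (extend v)) ≡ xorSum N (λ x → φ (v Vec.∷ʳ x))
  extensions v = trans (cong sumList (sym (map-∘ {g = φ} {f = v Vec.∷ʳ_} (upTo N))))
                       (sumList-map-applyUpTo N (λ x → φ (v Vec.∷ʳ x)) (λ x → x))
  lastEntry : ∀ x → sumList (map (λ v → φ (v Vec.∷ʳ x)) (bounded t))
                  ≡ τ x diag ∧ shift (x * 2 ^ suc t) (weightPoly a b t) w
  lastEntry x = begin
    sumList (map (λ v → φ (v Vec.∷ʳ x)) (bounded t))              ≡⟨ cong sumList (map-cong appended (bounded t)) ⟩
    sumList (map (λ v → shift m (ψ v) w ∧ τ x diag) (bounded t))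
      ≡⟨ sumList-map-∧ʳ (λ v → shift m (ψ v) w) (τ x diag) (bounded t) ⟩
    sumList (map (λ v → shift m (ψ v) w) (bounded t)) ∧ τ x diag
      ≡⟨ cong (_∧ τ x diag) (shift-sumList m ψ (bounded t) w) ⟨
    shift m (weightPoly a b t) w ∧ τ x diag                       ≡⟨ ∧-comm _ (τ x diag) ⟩
    τ x diag ∧ shift m (weightPoly a b t) w                       ∎
    where
    m = x * 2 ^ suc t
    ψ : Vec ℕ t → Poly
    ψ v w′ = monomial (weight v) w′ ∧ mulTerm a b v
    appended : ∀ v → φ (v Vec.∷ʳ x) ≡ shift m (ψ v) w ∧ τ x diag
    appended v = begin
      monomial (weight (v Vec.∷ʳ x)) w ∧ mulTerm a b (v Vec.∷ʳ x)
        ≡⟨ cong₂ _∧_ (cong (λ p → monomial p w) (weight-∷ʳ t v x)) (mulTerm-∷ʳ a b t v x) ⟩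
      monomial (weight v + m) w ∧ (mulTerm a b v ∧ τ x diag)
        ≡⟨ cong (_∧ (mulTerm a b v ∧ τ x diag)) (monomial-+ (weight v) m w) ⟩
      shift m (monomial (weight v)) w ∧ (mulTerm a b v ∧ τ x diag)  ≡⟨ ∧-assoc _ (mulTerm a b v) (τ x diag) ⟨
      (shift m (monomial (weight v)) w ∧ mulTerm a b v) ∧ τ x diag
        ≡⟨ cong (_∧ τ x diag) (shift-∧ʳ m (monomial (weight v)) (mulTerm a b v) w) ⟨
      shift m (ψ v) w ∧ τ x diag                                    ∎

columns : W → W → ℕ → List (ℕ × F2)
columns a b zero    = []
columns a b (suc t) = column (suc t) (diagTerms a b (suc t)) ++ columns a b t

weightPoly≡prodBinom : ∀ a b t w → weightPoly a b t w ≡ prodBinom (columns a b t) w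
weightPoly≡prodBinom a b zero    zero    = refl
weightPoly≡prodBinom a b zero    (suc w) = refl
weightPoly≡prodBinom a b (suc t) w = begin
  weightPoly a b (suc t) w                                               ≡⟨ weightPoly-suc a b t w ⟩
  xorSum N (λ x → τ x diag ∧ shift (x * 2 ^ suc t) (weightPoly a b t) w)
    ≡⟨ xorSum-cong N (λ x → cong (τ x diag ∧_) (shift-cong (x * 2 ^ suc t) (weightPoly≡prodBinom a b t) w)) ⟩
  xorSum N (λ x → τ x diag ∧ shift (x * 2 ^ suc t) (prodBinom (columns a b t)) w)
    ≡⟨ prodBinom-column (suc t) diag (columns a b t) N |diag|<N w ⟨
  prodBinom (columns a b (suc t)) w ∎
  where
  open ≡-Reasoning
  N = suc t + 2
  diag = diagTerms a b (suc t)
  |diag|<N : length diag < N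
  |diag|<N = subst (_< N)
    (sym (trans (length-map _ (upTo (suc (suc t)))) (length-applyUpTo (λ x → x) (suc (suc t)))))
                   (≤-reflexive (cong suc (+-comm 2 t)))

count : List F2 → ℕ
count []       = 0
count (c ∷ cs) = bitℕ c + count cs

exponent-column : ∀ s cs r → exponent (column s cs ++ r) ≡ count cs * 2 ^ s + exponent r
exponent-column s []       r = refl
exponent-column s (c ∷ cs) r = trans (cong (bitℕ c * 2 ^ s +_) (exponent-column s cs r))
  (trans (sym (+-assoc (bitℕ c * 2 ^ s) _ _))
         (cong (_+ exponent r) (sym (*-distribʳ-+ (2 ^ s) (bitℕ c) (count cs)))))

diagCount : W → W → ℕ → ℕ
diagCount a b k = ∑< (suc k) (λ j → bitℕ (a j ∧ b (k ∸ j)))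

count-diagTerms : ∀ a b k → count (diagTerms a b k) ≡ diagCount a b k
count-diagTerms a b k = count-map (suc k) (λ j → a j ∧ b (k ∸ j)) (λ j → j)
  where
  count-map : ∀ n (h : ℕ → F2) f → count (map h (applyUpTo f n)) ≡ ∑< n (λ j → bitℕ (h (f j)))
  count-map zero    h f = refl
  count-map (suc n) h f = cong (bitℕ (h (f 0)) +_) (count-map n h (f ∘ suc))

schoolbook : W → W → ℕ → ℕ
schoolbook a b zero    = diagCount a b 0
schoolbook a b (suc i) = schoolbook a b i + diagCount a b (suc i) * 2 ^ suc i

schoolbookTail : W → W → ℕ → ℕ
schoolbookTail a b zero    = 0
schoolbookTail a b (suc t) = diagCount a b (suc t) * 2 ^ t + schoolbookTail a b t

exponent-columns : ∀ a b t → exponent (columns a b t) ≡ 2 * schoolbookTail a b t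
exponent-columns a b zero    = refl
exponent-columns a b (suc t) = begin
  exponent (column (suc t) (diagTerms a b (suc t)) ++ columns a b t)
    ≡⟨ exponent-column (suc t) (diagTerms a b (suc t)) (columns a b t) ⟩
  count (diagTerms a b (suc t)) * 2 ^ suc t + exponent (columns a b t)
    ≡⟨ cong₂ (λ d e → d * 2 ^ suc t + e) (count-diagTerms a b (suc t)) (exponent-columns a b t) ⟩
  diagCount a b (suc t) * (2 * 2 ^ t) + 2 * schoolbookTail a b t
    ≡⟨ factor (diagCount a b (suc t)) (2 ^ t) (schoolbookTail a b t) ⟩
  2 * schoolbookTail a b (suc t) ∎
  where
  open ≡-Reasoning
  factor : ∀ d p x → d * (2 * p) + 2 * x ≡ 2 * (d * p + x)
  factor = solve-∀

schoolbook-split : ∀ a b t → schoolbook a b t ≡ diagCount a b 0 + 2 * schoolbookTail a b t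
schoolbook-split a b zero    = sym (+-identityʳ _)
schoolbook-split a b (suc t) = trans (cong (_+ diagCount a b (suc t) * 2 ^ suc t) (schoolbook-split a b t))
  (sym (factor (diagCount a b 0) (schoolbookTail a b t) (diagCount a b (suc t)) (2 ^ t)))
  where
  factor : ∀ d₀ x d p → d₀ + 2 * (d * p + x) ≡ d₀ + 2 * x + d * (2 * p)
  factor = solve-∀

digit-schoolbook : ∀ a b t → digit (schoolbook a b (suc t)) (suc t) ≡ sumList (map (mulTerm a b) (L₂ (suc t)))
digit-schoolbook a b t = begin
  digit (schoolbook a b (suc t)) (suc t)
    ≡⟨ cong (λ z → digit z (suc t)) (schoolbook-split a b (suc t)) ⟩
  digit (bitℕ (a 0 ∧ b 0) + 0 + 2 * X) (suc t)
    ≡⟨ cong (λ z → digit (z + 2 * X) (suc t)) (+-identityʳ (bitℕ (a 0 ∧ b 0))) ⟩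
  digit (bitℕ (a 0 ∧ b 0) + 2 * X) (suc t)              ≡⟨ digit-suc (a 0 ∧ b 0) X t ⟩
  digit X t                                             ≡⟨ digit-suc false X t ⟨
  digit (2 * X) (suc t)
    ≡⟨ cong (λ z → digit z (suc t)) (exponent-columns a b (suc t)) ⟨
  binom₂ (exponent (columns a b (suc t))) (2 ^ suc t)   ≡⟨ prodBinom≡binom₂ (columns a b (suc t)) _ ⟨
  prodBinom (columns a b (suc t)) (2 ^ suc t)           ≡⟨ weightPoly≡prodBinom a b (suc t) _ ⟨
  weightPoly a b (suc t) (2 ^ suc t)                    ≡⟨ L₂-sum≡weightPoly a b (suc t) ⟨
  sumList (map (mulTerm a b) (L₂ (suc t)))              ∎
  where
  open ≡-Reasoning
  X = schoolbookTail a b (suc t)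

2^j*[x*[y+2^[i∸j+1]*z]] : ∀ {j i} → j ≤ i → ∀ x y z →
  2 ^ j * (x * (y + 2 ^ suc (i ∸ j) * z)) ≡ 2 ^ j * (x * y) + 2 ^ suc i * (x * z)
2^j*[x*[y+2^[i∸j+1]*z]] {j} {i} j≤i x y z = begin
  2 ^ j * (x * (y + 2 ^ suc (i ∸ j) * z))                 ≡⟨ expand (2 ^ j) x y (2 ^ suc (i ∸ j)) z ⟩
  2 ^ j * (x * y) + 2 ^ j * 2 ^ suc (i ∸ j) * (x * z)
    ≡⟨ cong (λ p → 2 ^ j * (x * y) + p * (x * z)) (2^*2^[suc-∸]≡2^suc j≤i) ⟩
  2 ^ j * (x * y) + 2 ^ suc i * (x * z)                   ∎
  where
  open ≡-Reasoning
  expand : ∀ p x y q z → p * (x * (y + q * z)) ≡ p * (x * y) + p * q * (x * z)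
  expand = solve-∀

truncatedProduct : W → W → ℕ → ℕ
truncatedProduct a b i = ∑< (suc i) (λ j → 2 ^ j * (bitℕ (a j) * fromDigits b (i ∸ j)))

fromDigits-*-truncatedProduct : ∀ a b i →
  ∃ λ K → fromDigits a i * fromDigits b i ≡ truncatedProduct a b i + 2 ^ suc i * K
fromDigits-*-truncatedProduct a b i = ∑< (suc i) (λ j → bitℕ (a j) * digitsAbove b (i ∸ j) i) , (begin
  fromDigits a i * fromDigits b i
    ≡⟨ ∑<-*ʳ (suc i) (λ j → 2 ^ j * bitℕ (a j)) (fromDigits b i) ⟩
  ∑< (suc i) (λ j → 2 ^ j * bitℕ (a j) * fromDigits b i)   ≡⟨ ∑<-cong (suc i) split ⟩
  ∑< (suc i) (λ j → low j + 2 ^ suc i * high j)            ≡⟨ ∑<-+ (suc i) low (λ j → 2 ^ suc i * high j) ⟩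
  truncatedProduct a b i + ∑< (suc i) (λ j → 2 ^ suc i * high j)
    ≡⟨ cong (truncatedProduct a b i +_) (∑<-*ˡ (suc i) (2 ^ suc i) high) ⟩
  truncatedProduct a b i + 2 ^ suc i * ∑< (suc i) high     ∎)
  where
  open ≡-Reasoning
  low high : ℕ → ℕ
  low j  = 2 ^ j * (bitℕ (a j) * fromDigits b (i ∸ j))
  high j = bitℕ (a j) * digitsAbove b (i ∸ j) i
  split : ∀ j → j < suc i → 2 ^ j * bitℕ (a j) * fromDigits b i ≡ low j + 2 ^ suc i * high j
  split j (s≤s j≤i) = begin
    2 ^ j * bitℕ (a j) * fromDigits b i                                       ≡⟨ *-assoc (2 ^ j) _ _ ⟩
    2 ^ j * (bitℕ (a j) * fromDigits b i)
      ≡⟨ cong (λ z → 2 ^ j * (bitℕ (a j) * z)) (fromDigits-split b (m∸n≤m i j)) ⟩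
    2 ^ j * (bitℕ (a j) * (fromDigits b (i ∸ j) + 2 ^ suc (i ∸ j) * digitsAbove b (i ∸ j) i))
      ≡⟨ 2^j*[x*[y+2^[i∸j+1]*z]] j≤i (bitℕ (a j)) (fromDigits b (i ∸ j)) (digitsAbove b (i ∸ j) i) ⟩
    low j + 2 ^ suc i * high j ∎

truncatedProduct≡schoolbook : ∀ a b i → truncatedProduct a b i ≡ schoolbook a b i
truncatedProduct≡schoolbook a b zero = single (a 0) (b 0)
  where
  single : ∀ x y → 1 * (bitℕ x * (1 * bitℕ y + 0)) + 0 ≡ bitℕ (x ∧ y) + 0
  single true  true  = refl
  single true  false = refl
  single false y     = refl
truncatedProduct≡schoolbook a b (suc i) = begin
  ∑< (suc (suc i)) h                                         ≡⟨ ∑<-snoc (suc i) h ⟩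
  ∑< (suc i) h + h (suc i)                                   ≡⟨ cong (_+ h (suc i)) (∑<-cong (suc i) split) ⟩
  ∑< (suc i) (λ j → low j + 2 ^ suc i * diag j) + h (suc i)
    ≡⟨ cong (_+ h (suc i)) (∑<-+ (suc i) low (λ j → 2 ^ suc i * diag j)) ⟩
  truncatedProduct a b i + ∑< (suc i) (λ j → 2 ^ suc i * diag j) + h (suc i)
    ≡⟨ cong₂ (λ x y → x + y + h (suc i)) (truncatedProduct≡schoolbook a b i) (∑<-*ˡ (suc i) (2 ^ suc i) diag) ⟩
  schoolbook a b i + 2 ^ suc i * ∑< (suc i) diag + h (suc i)
    ≡⟨ cong (schoolbook a b i + 2 ^ suc i * ∑< (suc i) diag +_) last ⟩
  schoolbook a b i + 2 ^ suc i * ∑< (suc i) diag + 2 ^ suc i * diag (suc i)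
    ≡⟨ factor (schoolbook a b i) (2 ^ suc i) (∑< (suc i) diag) (diag (suc i)) ⟩
  schoolbook a b i + (∑< (suc i) diag + diag (suc i)) * 2 ^ suc i
    ≡⟨ cong (λ d → schoolbook a b i + d * 2 ^ suc i) (∑<-snoc (suc i) diag) ⟨
  schoolbook a b (suc i) ∎
  where
  open ≡-Reasoning
  h low diag : ℕ → ℕ
  h j    = 2 ^ j * (bitℕ (a j) * fromDigits b (suc i ∸ j))
  low j  = 2 ^ j * (bitℕ (a j) * fromDigits b (i ∸ j))
  diag j = bitℕ (a j ∧ b (suc i ∸ j))
  factor : ∀ x p s e → x + p * s + p * e ≡ x + (s + e) * p
  factor = solve-∀
  last : h (suc i) ≡ 2 ^ suc i * diag (suc i)
  last = cong (2 ^ suc i *_) (begin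
    bitℕ (a (suc i)) * fromDigits b (suc i ∸ suc i)
      ≡⟨ cong (λ k → bitℕ (a (suc i)) * fromDigits b k) (n∸n≡0 (suc i)) ⟩
    bitℕ (a (suc i)) * (1 * bitℕ (b 0) + 0)
      ≡⟨ cong (bitℕ (a (suc i)) *_) (trans (+-identityʳ _) (*-identityˡ _)) ⟩
    bitℕ (a (suc i)) * bitℕ (b 0)                     ≡⟨ bitℕ-∧ (a (suc i)) (b 0) ⟨
    bitℕ (a (suc i) ∧ b 0)                            ≡⟨ cong (λ k → bitℕ (a (suc i) ∧ b k)) (n∸n≡0 (suc i)) ⟨
    diag (suc i)                                      ∎)
  split : ∀ j → j < suc i → h j ≡ low j + 2 ^ suc i * diag j
  split j (s≤s j≤i) = begin
    2 ^ j * (bitℕ (a j) * fromDigits b (suc i ∸ j))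
      ≡⟨ cong (λ k → 2 ^ j * (bitℕ (a j) * fromDigits b k)) 1+i∸j≡ ⟩
    2 ^ j * (bitℕ (a j) * fromDigits b (suc (i ∸ j)))
      ≡⟨ cong (λ z → 2 ^ j * (bitℕ (a j) * z)) (fromDigits-suc b (i ∸ j)) ⟩
    2 ^ j * (bitℕ (a j) * (fromDigits b (i ∸ j) + 2 ^ suc (i ∸ j) * bitℕ (b (suc (i ∸ j)))))
      ≡⟨ 2^j*[x*[y+2^[i∸j+1]*z]] j≤i (bitℕ (a j)) (fromDigits b (i ∸ j)) (bitℕ (b (suc (i ∸ j)))) ⟩
    low j + 2 ^ suc i * (bitℕ (a j) * bitℕ (b (suc (i ∸ j))))
      ≡⟨ cong (λ z → low j + 2 ^ suc i * z)
              (trans (sym (bitℕ-∧ (a j) (b (suc (i ∸ j))))) (cong (λ k → bitℕ (a j ∧ b k)) (sym 1+i∸j≡))) ⟩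
    low j + 2 ^ suc i * diag j ∎
    where
    1+i∸j≡ : suc i ∸ j ≡ suc (i ∸ j)
    1+i∸j≡ = +-∸-assoc 1 j≤i

fromDigits-*≡schoolbook : ∀ a b i → ∃ λ K → fromDigits a i * fromDigits b i ≡ schoolbook a b i + 2 ^ suc i * K
fromDigits-*≡schoolbook a b i with fromDigits-*-truncatedProduct a b i
... | K , eq = K , trans eq (cong (_+ 2 ^ suc i * K) (truncatedProduct≡schoolbook a b i))

productDigits : W → W → W
productDigits a b i = digit (fromDigits a i * fromDigits b i) i

fromDigits-*-mod : ∀ a b {i n} → i ≤ n →
  ∃ λ K → fromDigits a n * fromDigits b n ≡ fromDigits a i * fromDigits b i + 2 ^ suc i * K
fromDigits-*-mod a b {i} {n} i≤n =
  _ , trans (cong₂ _*_ (fromDigits-split a i≤n) (fromDigits-split b i≤n))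
            (expand (fromDigits a i) (2 ^ suc i) (digitsAbove a i n) (fromDigits b i) (digitsAbove b i n))
  where
  expand : ∀ A p r B s → (A + p * r) * (B + p * s) ≡ A * B + p * (A * s + r * B + p * (r * s))
  expand = solve-∀

fromDigits-*-expansion : ∀ a b n →
  ∃ λ q → fromDigits a n * fromDigits b n ≡ fromDigits (productDigits a b) n + 2 ^ suc n * q
fromDigits-*-expansion a b n with binaryExpansion n (fromDigits a n * fromDigits b n)
... | q , eq = q , trans eq (cong (_+ 2 ^ suc n * q)
  (∑<-cong (suc n) (λ i i<1+n → cong (λ d → 2 ^ i * bitℕ d) (stable (≤-pred i<1+n)))))
  where
  stable : ∀ {i} → i ≤ n → digit (fromDigits a n * fromDigits b n) i ≡ productDigits a b i
  stable {i} i≤n with fromDigits-*-mod a b i≤n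
  ... | K , eq′ = trans (cong (λ M → digit M i) eq′) (digit-+2^suc* i (fromDigits a i * fromDigits b i) K)

productDigits≡digit-schoolbook : ∀ a b i → productDigits a b i ≡ digit (schoolbook a b i) i
productDigits≡digit-schoolbook a b i with fromDigits-*≡schoolbook a b i
... | K , eq = trans (cong (λ M → digit M i) eq) (digit-+2^suc* i (schoolbook a b i) K)

productDigits-zero : ∀ a b → productDigits a b 0 ≡ a 0 ∧ b 0
productDigits-zero a b = trans (productDigits≡digit-schoolbook a b 0) (digit-zero (a 0 ∧ b 0) 0)

productDigits-suc : ∀ a b t → productDigits a b (suc t) ≡ sumList (map (mulTerm a b) (L₂ (suc t)))
productDigits-suc a b t = trans (productDigits≡digit-schoolbook a b (suc t)) (digit-schoolbook a b t)

carry : W → W → ℕ → F2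
carry a b zero    = false
carry a b (suc n) = (a n ∧ b n) xor ((a n xor b n) ∧ carry a b n)

sumDigits : W → W → W
sumDigits a b n = (a n xor b n) xor carry a b n

fullAdder : ∀ c x y → bitℕ c + (bitℕ x + bitℕ y) ≡ bitℕ ((x xor y) xor c) + 2 * bitℕ ((x ∧ y) xor ((x xor y) ∧ c))
fullAdder true  true  true  = refl
fullAdder true  true  false = refl
fullAdder true  false true  = refl
fullAdder true  false false = refl
fullAdder false true  true  = refl
fullAdder false true  false = refl
fullAdder false false true  = refl
fullAdder false false false = refl

fromDigits-+ : ∀ a b n →
  fromDigits a n + fromDigits b n ≡ fromDigits (sumDigits a b) n + 2 ^ suc n * bitℕ (carry a b (suc n))
fromDigits-+ a b zero with a 0 | b 0
... | true  | true  = refl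
... | true  | false = refl
... | false | true  = refl
... | false | false = refl
fromDigits-+ a b (suc n) = begin
  fromDigits a (suc n) + fromDigits b (suc n)
    ≡⟨ cong₂ _+_ (fromDigits-suc a n) (fromDigits-suc b n) ⟩
  (A + p * x) + (B + p * y)                       ≡⟨ collect A p x B y ⟩
  (A + B) + p * (x + y)                           ≡⟨ cong (_+ p * (x + y)) (fromDigits-+ a b n) ⟩
  (S + p * c) + p * (x + y)                       ≡⟨ factor S p c (x + y) ⟩
  S + p * (c + (x + y))
    ≡⟨ cong (λ z → S + p * z) (fullAdder (carry a b (suc n)) (a (suc n)) (b (suc n))) ⟩
  S + p * (d + 2 * e)                             ≡⟨ expand S p d e ⟩
  (S + p * d) + 2 ^ suc (suc n) * e
    ≡⟨ cong (_+ 2 ^ suc (suc n) * e) (fromDigits-suc (sumDigits a b) n) ⟨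
  fromDigits (sumDigits a b) (suc n) + 2 ^ suc (suc n) * e ∎
  where
  open ≡-Reasoning
  A = fromDigits a n
  B = fromDigits b n
  S = fromDigits (sumDigits a b) n
  p = 2 ^ suc n
  x = bitℕ (a (suc n))
  y = bitℕ (b (suc n))
  c = bitℕ (carry a b (suc n))
  d = bitℕ (sumDigits a b (suc n))
  e = bitℕ (carry a b (suc (suc n)))
  collect : ∀ A p x B y → (A + p * x) + (B + p * y) ≡ (A + B) + p * (x + y)
  collect = solve-∀
  factor : ∀ S p c z → (S + p * c) + p * z ≡ S + p * (c + z)
  factor = solve-∀
  expand : ∀ S p d e → S + p * (d + 2 * e) ≡ (S + p * d) + 2 * p * e
  expand = solve-∀

-- the carry out of position t is generated at some i ≤ t and propagated through i+1, …, t
carry≡Σgenerate∧propagate : ∀ a b t → carry a b (suc t) ≡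
  Σ< (suc t) (λ i → (a i ∧ b i) ∧ Πrange (suc i) (suc t) (λ j → a j xor b j))
carry≡Σgenerate∧propagate a b zero with a 0 | b 0
... | true  | true  = refl
... | true  | false = refl
... | false | true  = refl
... | false | false = refl
carry≡Σgenerate∧propagate a b (suc t) = begin
  G xor (P ∧ carry a b (suc t))                    ≡⟨ xor-comm G _ ⟩
  (P ∧ carry a b (suc t)) xor G                    ≡⟨ cong₂ _xor_ (∧-comm _ P) (∧-identityʳ G) ⟨
  (carry a b (suc t) ∧ P) xor (G ∧ true)
    ≡⟨ cong (λ z → (z ∧ P) xor (G ∧ true)) (carry≡Σgenerate∧propagate a b t) ⟩
  (Σ< (suc t) (term (suc t)) ∧ P) xor (G ∧ true)   ≡⟨ cong (_xor (G ∧ true)) (Σ<-∧ʳ (suc t) (term (suc t)) P) ⟨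
  Σ< (suc t) (λ i → term (suc t) i ∧ P) xor (G ∧ true)
    ≡⟨ cong₂ _xor_ (Σ<-cong (suc t) (λ i i<1+t → extend i (≤-pred i<1+t)))
                   (cong (G ∧_) (Πrange-empty (suc t) ab)) ⟨
  Σ< (suc (suc t)) (term (suc (suc t)))            ∎
  where
  open ≡-Reasoning
  G = a (suc t) ∧ b (suc t)
  P = a (suc t) xor b (suc t)
  ab : ℕ → F2
  ab j = a j xor b j
  term : ℕ → ℕ → F2
  term n i = (a i ∧ b i) ∧ Πrange (suc i) n ab
  extend : ∀ i → i ≤ t → term (suc (suc t)) i ≡ term (suc t) i ∧ P
  extend i i≤t = trans (cong ((a i ∧ b i) ∧_) (Πrange-snoc ab i≤t)) (sym (∧-assoc (a i ∧ b i) _ P))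

unitDigits : W
unitDigits zero    = true
unitDigits (suc _) = false

fromDigits-unitDigits : ∀ n → fromDigits unitDigits n ≡ 1
fromDigits-unitDigits n = cong suc (trans (∑<-cong n (λ j _ → *-zeroʳ (2 ^ suc j))) (∑<-zero n))
  where
  ∑<-zero : ∀ n → ∑< n (λ _ → 0) ≡ 0
  ∑<-zero zero    = refl
  ∑<-zero (suc n) = ∑<-zero n

fromDigits-complement : ∀ a n → fromDigits (not ∘ a) n + 1 + fromDigits a n ≡ 2 ^ suc n
fromDigits-complement a zero with a 0
... | true  = refl
... | false = refl
fromDigits-complement a (suc n) = begin
  fromDigits (not ∘ a) (suc n) + 1 + fromDigits a (suc n)
    ≡⟨ cong₂ (λ x y → x + 1 + y) (fromDigits-suc (not ∘ a) n) (fromDigits-suc a n) ⟩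
  (N + p * bitℕ (not x)) + 1 + (A + p * bitℕ x)   ≡⟨ regroup N p (bitℕ (not x)) A (bitℕ x) ⟩
  (N + 1 + A) + p * (bitℕ (not x) + bitℕ x)
    ≡⟨ cong₂ (λ u v → u + p * v) (fromDigits-complement a n) (not+id x) ⟩
  p + p * 1                                        ≡⟨ double p ⟩
  2 ^ suc (suc n)                                  ∎
  where
  open ≡-Reasoning
  N = fromDigits (not ∘ a) n
  A = fromDigits a n
  p = 2 ^ suc n
  x = a (suc n)
  not+id : ∀ x → bitℕ (not x) + bitℕ x ≡ 1
  not+id true  = refl
  not+id false = refl
  regroup : ∀ N p y A z → N + p * y + 1 + (A + p * z) ≡ (N + 1 + A) + p * (y + z)
  regroup = solve-∀
  double : ∀ p → p + p * 1 ≡ 2 * p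
  double = solve-∀

carry-complement-unit : ∀ a t → carry (not ∘ a) unitDigits (suc t) ≡ Π< (suc t) (λ i → true xor a i)
carry-complement-unit a zero with a 0
... | true  = refl
... | false = refl
carry-complement-unit a (suc t) =
  trans (cong (λ c → (not x ∧ false) xor ((not x xor false) ∧ c)) (carry-complement-unit a t))
        (step x (Π< (suc t) (λ i → true xor a i)))
  where
  x = a (suc t)
  step : ∀ x P → (not x ∧ false) xor ((not x xor false) ∧ P) ≡ P ∧ (true xor x)
  step true  true  = refl
  step true  false = refl
  step false true  = refl
  step false false = refl

-- -A = (not A) + 1
negDigits : W → W
negDigits a = sumDigits (not ∘ a) unitDigits

negDigits-zero : ∀ a → negDigits a 0 ≡ a 0
negDigits-zero a with a 0
... | true  = refl
... | false = refl

negDigits-suc : ∀ a t → negDigits a (suc t) ≡ (a (suc t) xor true) xor Π< (suc t) (λ i → true xor a i)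
negDigits-suc a t = cong₂ _xor_ (not-xor-false (a (suc t))) (carry-complement-unit a t)
  where
  not-xor-false : ∀ x → not x xor false ≡ x xor true
  not-xor-false true  = refl
  not-xor-false false = refl

-- The integers are opened only here: with ℤ's constructor +_ in scope, ℕ sections such as (x +_) are ambiguous.
module _ where
  open import Data.Integer as ℤ using (ℤ; +_; +[1+_]; -[1+_]; _/ℕ_; _%ℕ_)
    renaming (_+_ to _+ℤ_; _*_ to _*ℤ_; _-_ to _-ℤ_; -_ to -ℤ_; _^_ to _^ℤ_)
  import Data.Integer.Properties as ℤ
  open import Data.Integer.DivMod using (a≡a%ℕn+[a/ℕn]*n; n%ℕd<d)
  open import Data.List using (_∷ʳ_)
  open import Data.List.Properties using (length-++)
  open import Data.Sum using (inj₁; inj₂)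
  import Data.Integer.Tactic.RingSolver as ℤ-Solver

  infix 4 _≡_⟨mod_⟩
  _≡_⟨mod_⟩ : ℤ → ℤ → ℕ → Set
  x ≡ y ⟨mod m ⟩ = ∃ λ k → x ≡ y +ℤ k *ℤ + m

  no-positive-multiple-below : ∀ d r r′ m → r < d → + r ≢ + r′ +ℤ +[1+ m ] *ℤ + d
  no-positive-multiple-below d r r′ m r<d r≡ = <⇒≱ r<d (begin
    d                  ≤⟨ m≤n*m d (suc m) ⟩
    suc m * d          ≤⟨ m≤n+m (suc m * d) r′ ⟩
    r′ + suc m * d     ≡⟨ ℤ.+-injective (trans r≡ (cong (+ r′ +ℤ_) (sym (ℤ.pos-* (suc m) d)))) ⟨
    r                  ∎)
    where open ≤-Reasoning

  quotient-unique : ∀ d r r′ δ → r < d → r′ < d → + r ≡ + r′ +ℤ δ *ℤ + d → δ ≡ + 0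
  quotient-unique d r r′ (+ zero)   _   _    _  = refl
  quotient-unique d r r′ +[1+ m ]   r<d _    r≡ = ⊥-elim (no-positive-multiple-below d r r′ m r<d r≡)
  quotient-unique d r r′ -[1+ m ]   _   r′<d r≡ = ⊥-elim (no-positive-multiple-below d r′ r m r′<d (begin
    + r′                                      ≡⟨ move (+ r) (+ r′) (-[1+ m ] *ℤ + d) r≡ ⟩
    + r +ℤ -ℤ (-[1+ m ] *ℤ + d)               ≡⟨ cong (+ r +ℤ_) (ℤ.neg-distribˡ-* -[1+ m ] (+ d)) ⟩
    + r +ℤ +[1+ m ] *ℤ + d                    ∎))
    where
    open ≡-Reasoning
    move : ∀ x y z → x ≡ y +ℤ z → y ≡ x +ℤ -ℤ z
    move _ y z refl = sym (cancel y z)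
      where
      cancel : ∀ y z → y +ℤ z +ℤ -ℤ z ≡ y
      cancel = ℤ-Solver.solve-∀

  divMod-unique : ∀ d .{{_ : NonZero d}} x r k → r < d → x ≡ + r +ℤ k *ℤ + d → (x /ℕ d ≡ k) × (x %ℕ d ≡ r)
  divMod-unique d x r k r<d x≡ = sym (ℤ.i-j≡0⇒i≡j k (x /ℕ d) δ≡0) , ℤ.+-injective remainders
    where
    open ≡-Reasoning
    δ = k -ℤ x /ℕ d
    rearrange : ∀ r k r′ k′ d → r +ℤ k *ℤ d ≡ r′ +ℤ k′ *ℤ d → r ≡ r′ +ℤ (k′ -ℤ k) *ℤ d
    rearrange r k r′ k′ d e = trans (sym (h1 r k d)) (trans (cong (_+ℤ (-ℤ k) *ℤ d) e) (h2 r′ k′ k d))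
      where
      h1 : ∀ r k d → r +ℤ k *ℤ d +ℤ (-ℤ k) *ℤ d ≡ r
      h1 = ℤ-Solver.solve-∀
      h2 : ∀ r′ k′ k d → r′ +ℤ k′ *ℤ d +ℤ (-ℤ k) *ℤ d ≡ r′ +ℤ (k′ -ℤ k) *ℤ d
      h2 = ℤ-Solver.solve-∀
    x%d≡ : + (x %ℕ d) ≡ + r +ℤ δ *ℤ + d
    x%d≡ = rearrange (+ (x %ℕ d)) (x /ℕ d) (+ r) k (+ d) (trans (sym (a≡a%ℕn+[a/ℕn]*n x d)) x≡)
    δ≡0 : δ ≡ + 0
    δ≡0 = quotient-unique d (x %ℕ d) r δ (n%ℕd<d x d) r<d x%d≡
    remainders : + (x %ℕ d) ≡ + r
    remainders = trans x%d≡ (trans (cong (λ z → + r +ℤ z *ℤ + d) δ≡0) (ℤ.+-identityʳ (+ r)))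

  bit-mod-2 : ∀ x c → x ≡ + bitℕ c ⟨mod 2 ⟩ → red x ≡ c
  bit-mod-2 x c (k , x≡) = trans (cong (_≡ᵇ 1) (proj₂ (divMod-unique 2 x (bitℕ c) k (bit<2 c) x≡))) (bit≡ᵇ1 c)
    where
    bit<2 : ∀ c → bitℕ c < 2
    bit<2 true  = s≤s (s≤s z≤n)
    bit<2 false = s≤s z≤n
    bit≡ᵇ1 : ∀ c → (bitℕ c ≡ᵇ 1) ≡ c
    bit≡ᵇ1 true  = refl
    bit≡ᵇ1 false = refl

  -- squaring a lift of a bit doubles the modulus, as bitℕ c is idempotent
  ^2^-mod : ∀ e x c → x ≡ + bitℕ c ⟨mod 2 ⟩ → x ^ℤ (2 ^ e) ≡ + bitℕ c ⟨mod 2 ^ suc e ⟩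
  ^2^-mod zero    x c (k , x≡) = k , trans (ℤ.^-identityʳ x) x≡
  ^2^-mod (suc e) x c x≡c with ^2^-mod e x c x≡c
  ... | k , y≡ = (+ bitℕ c *ℤ k +ℤ k *ℤ k *ℤ q) , (begin
    x ^ℤ (2 ^ suc e)       ≡⟨ cong (λ k → x ^ℤ (2 ^ e + k)) (+-identityʳ (2 ^ e)) ⟩
    x ^ℤ (2 ^ e + 2 ^ e)   ≡⟨ ℤ.^-distribˡ-+-* x (2 ^ e) (2 ^ e) ⟩
    y *ℤ y                 ≡⟨ cong₂ _*ℤ_ y≡′ y≡′ ⟩
    (c′ +ℤ k *ℤ (+ 2 *ℤ q)) *ℤ (c′ +ℤ k *ℤ (+ 2 *ℤ q))   ≡⟨ square c′ k q ⟩
    c′ *ℤ c′ +ℤ (c′ *ℤ k +ℤ k *ℤ k *ℤ q) *ℤ (+ 2 *ℤ (+ 2 *ℤ q))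
      ≡⟨ cong₂ (λ u v → u +ℤ (c′ *ℤ k +ℤ k *ℤ k *ℤ q) *ℤ v) (idempotent c)
               (trans (cong (+ 2 *ℤ_) (sym (ℤ.pos-* 2 (2 ^ e)))) (sym (ℤ.pos-* 2 (2 * 2 ^ e)))) ⟩
    c′ +ℤ (c′ *ℤ k +ℤ k *ℤ k *ℤ q) *ℤ + (2 ^ suc (suc e)) ∎)
    where
    open ≡-Reasoning
    y = x ^ℤ (2 ^ e)
    q = + (2 ^ e)
    c′ = + bitℕ c
    y≡′ : y ≡ c′ +ℤ k *ℤ (+ 2 *ℤ q)
    y≡′ = trans y≡ (cong (λ z → c′ +ℤ k *ℤ z) (ℤ.pos-* 2 (2 ^ e)))
    idempotent : ∀ c → + bitℕ c *ℤ + bitℕ c ≡ + bitℕ c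
    idempotent true  = refl
    idempotent false = refl
    square : ∀ c k q → (c +ℤ k *ℤ (+ 2 *ℤ q)) *ℤ (c +ℤ k *ℤ (+ 2 *ℤ q))
                        ≡ c *ℤ c +ℤ (c *ℤ k +ℤ k *ℤ k *ℤ q) *ℤ (+ 2 *ℤ (+ 2 *ℤ q))
    square = ℤ-Solver.solve-∀

  gs-∷ʳ : ∀ n i xs x →
    gs n i (xs ∷ʳ x) ≡ gs n i xs +ℤ + (2 ^ (i + length xs)) *ℤ (x ^ℤ (2 ^ (n ∸ (i + length xs))))
  gs-∷ʳ n i [] x = begin
    + (2 ^ i) *ℤ (x ^ℤ (2 ^ (n ∸ i))) +ℤ + 0                    ≡⟨ ℤ.+-identityʳ _ ⟩
    + (2 ^ i) *ℤ (x ^ℤ (2 ^ (n ∸ i)))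
      ≡⟨ cong (λ k → + (2 ^ k) *ℤ (x ^ℤ (2 ^ (n ∸ k)))) (+-identityʳ i) ⟨
    + (2 ^ (i + 0)) *ℤ (x ^ℤ (2 ^ (n ∸ (i + 0))))               ≡⟨ ℤ.+-identityˡ _ ⟨
    + 0 +ℤ + (2 ^ (i + 0)) *ℤ (x ^ℤ (2 ^ (n ∸ (i + 0))))        ∎
    where open ≡-Reasoning
  gs-∷ʳ n i (y ∷ xs) x = begin
    t +ℤ gs n (suc i) (xs ∷ʳ x)                                  ≡⟨ cong (t +ℤ_) (gs-∷ʳ n (suc i) xs x) ⟩
    t +ℤ (gs n (suc i) xs +ℤ last (suc i + length xs))           ≡⟨ ℤ.+-assoc t _ _ ⟨
    t +ℤ gs n (suc i) xs +ℤ last (suc i + length xs)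
      ≡⟨ cong (λ k → t +ℤ gs n (suc i) xs +ℤ last k) (+-suc i (length xs)) ⟨
    t +ℤ gs n (suc i) xs +ℤ last (i + suc (length xs))           ∎
    where
    open ≡-Reasoning
    t = + (2 ^ i) *ℤ (y ^ℤ (2 ^ (n ∸ i)))
    last : ℕ → ℤ
    last k = + (2 ^ k) *ℤ (x ^ℤ (2 ^ (n ∸ k)))

  length-prefix : ∀ g m → length (prefix g m) ≡ m
  length-prefix g zero    = refl
  length-prefix g (suc m) = trans (length-++ (prefix g m)) (trans (cong (_+ 1) (length-prefix g m)) (+-comm m 1))

  prefix-ghostSum : ∀ g (u : W) m n → (∀ i → i < m → fromGhost g i ≡ + bitℕ (u i) ⟨mod 2 ⟩) → m ≤ n →
    gs n 0 (prefix g m) ≡ + ∑< m (λ i → 2 ^ i * bitℕ (u i)) ⟨mod 2 ^ suc n ⟩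
  prefix-ghostSum g u zero    n _  _   = + 0 , refl
  prefix-ghostSum g u (suc m) n s≡u 1+m≤n
    with prefix-ghostSum g u m n (λ i i<m → s≡u i (≤-trans i<m (n≤1+n m))) (≤-trans (n≤1+n m) 1+m≤n)
       | ^2^-mod (n ∸ m) (fromGhost g m) (u m) (s≡u m ≤-refl)
  ... | k , gs≡ | k′ , s^≡ = (k +ℤ k′) , (begin
    gs n 0 (prefix g m ∷ʳ s)                                 ≡⟨ gs-∷ʳ n 0 (prefix g m) s ⟩
    gs n 0 (prefix g m) +ℤ term (length (prefix g m))
      ≡⟨ cong (λ l → gs n 0 (prefix g m) +ℤ term l) (length-prefix g m) ⟩
    gs n 0 (prefix g m) +ℤ term m                            ≡⟨ cong₂ (λ x y → x +ℤ + (2 ^ m) *ℤ y) gs≡ s^≡ ⟩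
    + S +ℤ k *ℤ + P +ℤ A *ℤ (+ bitℕ (u m) +ℤ k′ *ℤ Q)
      ≡⟨ cong (λ p → + S +ℤ k *ℤ p +ℤ A *ℤ (+ bitℕ (u m) +ℤ k′ *ℤ Q)) A*Q≡P ⟨
    + S +ℤ k *ℤ (A *ℤ Q) +ℤ A *ℤ (+ bitℕ (u m) +ℤ k′ *ℤ Q)   ≡⟨ regroup (+ S) k A (+ bitℕ (u m)) k′ Q ⟩
    (+ S +ℤ A *ℤ + bitℕ (u m)) +ℤ (k +ℤ k′) *ℤ (A *ℤ Q)
      ≡⟨ cong₂ (λ x y → x +ℤ (k +ℤ k′) *ℤ y)
               (trans (cong (+ S +ℤ_) (sym (ℤ.pos-* (2 ^ m) (bitℕ (u m))))) (cong +_ (sym (∑<-snoc m f))))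
               A*Q≡P ⟩
    + ∑< (suc m) f +ℤ (k +ℤ k′) *ℤ + P ∎)
    where
    open ≡-Reasoning
    s = fromGhost g m
    f : ℕ → ℕ
    f i = 2 ^ i * bitℕ (u i)
    S = ∑< m f
    P = 2 ^ suc n
    A = + (2 ^ m)
    Q = + (2 ^ suc (n ∸ m))
    term : ℕ → ℤ
    term l = + (2 ^ l) *ℤ (s ^ℤ (2 ^ (n ∸ l)))
    A*Q≡P : A *ℤ Q ≡ + P
    A*Q≡P = trans (sym (ℤ.pos-* (2 ^ m) _)) (cong +_ (2^*2^[suc-∸]≡2^suc (≤-trans (n≤1+n m) 1+m≤n)))
    regroup : ∀ S k A b k′ Q → S +ℤ k *ℤ (A *ℤ Q) +ℤ A *ℤ (b +ℤ k′ *ℤ Q) ≡ (S +ℤ A *ℤ b) +ℤ (k +ℤ k′) *ℤ (A *ℤ Q)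
    regroup = ℤ-Solver.solve-∀

  -- s_n = (g_n - Σ_{i<n} 2^i s_i^(2^(n-i))) / 2^n, and the numerator is 2^n u_n modulo 2^(n+1)
  fromGhost-next : ∀ g (u : W) → (∀ n → g n ≡ + fromDigits u n ⟨mod 2 ^ suc n ⟩) →
    ∀ n → (∀ i → i < n → fromGhost g i ≡ + bitℕ (u i) ⟨mod 2 ⟩) → fromGhost g n ≡ + bitℕ (u n) ⟨mod 2 ⟩
  fromGhost-next g u g≡u n s≡u with g≡u n | prefix-ghostSum g u n n s≡u ≤-refl
  ... | k , g≡ | k′ , gs≡ = (k -ℤ k′) , proj₁ (divMod-unique (2 ^ n) {{m^n≢0 2 n}} x 0 q (m^n>0 2 n) x≡)
    where
    open ≡-Reasoning
    f : ℕ → ℕ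
    f i = 2 ^ i * bitℕ (u i)
    V = ∑< n f
    A = + (2 ^ n)
    x = g n -ℤ gs n 0 (prefix g n)
    q = + bitℕ (u n) +ℤ (k -ℤ k′) *ℤ + 2
    cancel : ∀ V k k′ A b →
      (V +ℤ A *ℤ b) +ℤ k *ℤ (+ 2 *ℤ A) -ℤ (V +ℤ k′ *ℤ (+ 2 *ℤ A)) ≡ + 0 +ℤ (b +ℤ (k -ℤ k′) *ℤ + 2) *ℤ A
    cancel = ℤ-Solver.solve-∀
    x≡ : x ≡ + 0 +ℤ q *ℤ A
    x≡ = begin
      g n -ℤ gs n 0 (prefix g n)                                   ≡⟨ cong₂ _-ℤ_ g≡ gs≡ ⟩
      + fromDigits u n +ℤ k *ℤ + (2 ^ suc n) -ℤ (+ V +ℤ k′ *ℤ + (2 ^ suc n))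
        ≡⟨ cong₂ (λ y p → y +ℤ k *ℤ p -ℤ (+ V +ℤ k′ *ℤ p))
                 (trans (cong +_ (∑<-snoc n f))
                        (trans (ℤ.pos-+ V _) (cong (+ V +ℤ_) (ℤ.pos-* (2 ^ n) (bitℕ (u n))))))
                 (ℤ.pos-* 2 (2 ^ n)) ⟩
      (+ V +ℤ A *ℤ + bitℕ (u n)) +ℤ k *ℤ (+ 2 *ℤ A) -ℤ (+ V +ℤ k′ *ℤ (+ 2 *ℤ A))
        ≡⟨ cancel (+ V) k k′ A (+ bitℕ (u n)) ⟩
      + 0 +ℤ q *ℤ A                                                ∎

  fromGhost-below : ∀ g (u : W) → (∀ n → g n ≡ + fromDigits u n ⟨mod 2 ^ suc n ⟩) →
    ∀ n i → i < n → fromGhost g i ≡ + bitℕ (u i) ⟨mod 2 ⟩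
  fromGhost-below g u g≡u (suc n) i (s≤s i≤n) with m≤n⇒m<n∨m≡n i≤n
  ... | inj₁ i<n  = fromGhost-below g u g≡u n i i<n
  ... | inj₂ refl = fromGhost-next g u g≡u i (fromGhost-below g u g≡u i)

  red-fromGhost : ∀ g (u : W) → (∀ n → g n ≡ + fromDigits u n ⟨mod 2 ^ suc n ⟩) → ∀ n → red (fromGhost g n) ≡ u n
  red-fromGhost g u g≡u n = bit-mod-2 (fromGhost g n) (u n) (fromGhost-below g u g≡u (suc n) n ≤-refl)

  gs-map-lift : ∀ n i bs → gs n i (map lift bs) ≡ + (2 ^ i * bitsValue bs)
  gs-map-lift n i []       = cong +_ (sym (*-zeroʳ (2 ^ i)))
  gs-map-lift n i (b ∷ bs) = begin
    + (2 ^ i) *ℤ (lift b ^ℤ (2 ^ (n ∸ i))) +ℤ gs n (suc i) (map lift bs)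
      ≡⟨ cong₂ (λ x y → + (2 ^ i) *ℤ x +ℤ y) (lift^ b (2 ^ (n ∸ i)) (m^n>0 2 (n ∸ i))) (gs-map-lift n (suc i) bs) ⟩
    + (2 ^ i) *ℤ + bitℕ b +ℤ + (2 ^ suc i * bitsValue bs)
      ≡⟨ cong (_+ℤ + (2 ^ suc i * bitsValue bs)) (ℤ.pos-* (2 ^ i) (bitℕ b)) ⟨
    + (2 ^ i * bitℕ b) +ℤ + (2 ^ suc i * bitsValue bs)
      ≡⟨ ℤ.pos-+ (2 ^ i * bitℕ b) _ ⟨
    + (2 ^ i * bitℕ b + 2 ^ suc i * bitsValue bs)
      ≡⟨ cong +_ (factor (2 ^ i) (bitℕ b) (bitsValue bs)) ⟩
    + (2 ^ i * (bitℕ b + 2 * bitsValue bs)) ∎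
    where
    open ≡-Reasoning
    lift^ : ∀ c m → 1 ≤ m → lift c ^ℤ m ≡ + bitℕ c
    lift^ true  m       _ = ℤ.^-zeroˡ m
    lift^ false (suc m) _ = refl
    factor : ∀ p b v → p * b + 2 * p * v ≡ p * (b + 2 * v)
    factor = solve-∀

  ghost-liftW : ∀ a n → ghost (liftW a) n ≡ + fromDigits a n
  ghost-liftW a n = begin
    gs n 0 (map (lift ∘ a) (upTo (suc n)))          ≡⟨ cong (gs n 0) (map-∘ (upTo (suc n))) ⟩
    gs n 0 (map lift (map a (upTo (suc n))))        ≡⟨ gs-map-lift n 0 (map a (upTo (suc n))) ⟩
    + (1 * bitsValue (map a (upTo (suc n))))
      ≡⟨ cong +_ (trans (*-identityˡ _) (bitsValue-map-applyUpTo a (λ j → j) (suc n))) ⟩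
    + fromDigits a n                                ∎
    where open ≡-Reasoning

  ∔-digits : ∀ a b n → (a ∔ b) n ≡ sumDigits a b n
  ∔-digits a b = red-fromGhost _ (sumDigits a b) ghost-sum
    where
    ghost-sum : ∀ n → ghost (liftW a) n +ℤ ghost (liftW b) n ≡ + fromDigits (sumDigits a b) n ⟨mod 2 ^ suc n ⟩
    ghost-sum n = + bitℕ c , (begin
      ghost (liftW a) n +ℤ ghost (liftW b) n       ≡⟨ cong₂ _+ℤ_ (ghost-liftW a n) (ghost-liftW b n) ⟩
      + fromDigits a n +ℤ + fromDigits b n         ≡⟨ ℤ.pos-+ (fromDigits a n) _ ⟨
      + (fromDigits a n + fromDigits b n)          ≡⟨ cong +_ (fromDigits-+ a b n) ⟩
      + (S + 2 ^ suc n * bitℕ c)                   ≡⟨ cong (λ k → + (S + k)) (*-comm (2 ^ suc n) (bitℕ c)) ⟩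
      + (S + bitℕ c * 2 ^ suc n)                   ≡⟨ ℤ.pos-+ S _ ⟩
      + S +ℤ + (bitℕ c * 2 ^ suc n)                ≡⟨ cong (+ S +ℤ_) (ℤ.pos-* (bitℕ c) (2 ^ suc n)) ⟩
      + S +ℤ + bitℕ c *ℤ + (2 ^ suc n)             ∎)
      where
      open ≡-Reasoning
      S = fromDigits (sumDigits a b) n
      c = carry a b (suc n)

  ∸W-digits : ∀ a n → (∸W a) n ≡ negDigits a n
  ∸W-digits a = red-fromGhost _ (negDigits a) ghost-neg
    where
    ghost-neg : ∀ n → -ℤ ghost (liftW a) n ≡ + fromDigits (negDigits a) n ⟨mod 2 ^ suc n ⟩
    ghost-neg n = (+ bitℕ c -ℤ + 1) , (begin
      -ℤ ghost (liftW a) n                               ≡⟨ cong -ℤ_ (ghost-liftW a n) ⟩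
      -ℤ + A                                             ≡⟨ subtract (+ S) (+ P) (+ bitℕ c) (+ A) ⟩
      + S +ℤ + bitℕ c *ℤ + P -ℤ (+ S +ℤ + P *ℤ + bitℕ c +ℤ + A)
        ≡⟨ cong (λ z → + S +ℤ + bitℕ c *ℤ + P -ℤ z) S+Pc+A≡P ⟩
      + S +ℤ + bitℕ c *ℤ + P -ℤ + P                      ≡⟨ factor (+ S) (+ P) (+ bitℕ c) ⟩
      + S +ℤ (+ bitℕ c -ℤ + 1) *ℤ + P                    ∎)
      where
      open ≡-Reasoning
      A = fromDigits a n
      S = fromDigits (negDigits a) n
      P = 2 ^ suc n
      c = carry (not ∘ a) unitDigits (suc n)
      subtract : ∀ S P c A → -ℤ A ≡ S +ℤ c *ℤ P -ℤ (S +ℤ P *ℤ c +ℤ A)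
      subtract = ℤ-Solver.solve-∀
      factor : ∀ S P c → S +ℤ c *ℤ P -ℤ P ≡ S +ℤ (c -ℤ + 1) *ℤ P
      factor = ℤ-Solver.solve-∀
      S+Pc+A≡P : + S +ℤ + P *ℤ + bitℕ c +ℤ + A ≡ + P
      S+Pc+A≡P = begin
        + S +ℤ + P *ℤ + bitℕ c +ℤ + A           ≡⟨ cong (λ z → + S +ℤ z +ℤ + A) (ℤ.pos-* P (bitℕ c)) ⟨
        + S +ℤ + (P * bitℕ c) +ℤ + A            ≡⟨ cong (_+ℤ + A) (ℤ.pos-+ S _) ⟨
        + (S + P * bitℕ c) +ℤ + A               ≡⟨ ℤ.pos-+ (S + P * bitℕ c) A ⟨
        + (S + P * bitℕ c + A)                  ≡⟨ cong (λ z → + (z + A)) (fromDigits-+ (not ∘ a) unitDigits n) ⟨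
        + (fromDigits (not ∘ a) n + fromDigits unitDigits n + A)
          ≡⟨ cong (λ z → + (fromDigits (not ∘ a) n + z + A)) (fromDigits-unitDigits n) ⟩
        + (fromDigits (not ∘ a) n + 1 + A)      ≡⟨ cong +_ (fromDigits-complement a n) ⟩
        + P                                     ∎

  ⊛-digits : ∀ a b n → (a ⊛ b) n ≡ productDigits a b n
  ⊛-digits a b = red-fromGhost _ (productDigits a b) ghost-product
    where
    ghost-product : ∀ n →
      ghost (liftW a) n *ℤ ghost (liftW b) n ≡ + fromDigits (productDigits a b) n ⟨mod 2 ^ suc n ⟩
    ghost-product n with fromDigits-*-expansion a b n
    ... | q , AB≡ = + q , (begin
      ghost (liftW a) n *ℤ ghost (liftW b) n       ≡⟨ cong₂ _*ℤ_ (ghost-liftW a n) (ghost-liftW b n) ⟩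
      + fromDigits a n *ℤ + fromDigits b n         ≡⟨ ℤ.pos-* (fromDigits a n) _ ⟨
      + (fromDigits a n * fromDigits b n)          ≡⟨ cong +_ AB≡ ⟩
      + (S + 2 ^ suc n * q)                        ≡⟨ cong (λ k → + (S + k)) (*-comm (2 ^ suc n) q) ⟩
      + (S + q * 2 ^ suc n)                        ≡⟨ ℤ.pos-+ S _ ⟩
      + S +ℤ + (q * 2 ^ suc n)                     ≡⟨ cong (+ S +ℤ_) (ℤ.pos-* q (2 ^ suc n)) ⟩
      + S +ℤ + q *ℤ + (2 ^ suc n)                  ∎)
      where
      open ≡-Reasoning
      S = fromDigits (productDigits a b) n

theorem6p1 : (a b : W) →
    (((a ∔ b) 0 ≡ (a 0 xor b 0))
      × (∀ t → (a ∔ b) (suc t)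
           ≡ ((a (suc t) xor b (suc t))
              xor Σ< (suc t) (λ i → (a i ∧ b i) ∧ Πrange (suc i) (suc t) (λ j → a j xor b j)))))
    × (((∸W a) 0 ≡ a 0)
      × (∀ t → (∸W a) (suc t)
           ≡ ((a (suc t) xor true) xor Π< (suc t) (λ i → true xor a i))))
    × (((a ⊛ b) 0 ≡ (a 0 ∧ b 0))
      × (∀ t → (a ⊛ b) (suc t)
           ≡ sumList (map (mulTerm a b) (L₂ (suc t)))))
theorem6p1 a b =
  ( trans (∔-digits a b 0) (xor-identityʳ (a 0 xor b 0))
  , λ t → trans (∔-digits a b (suc t))
                (cong ((a (suc t) xor b (suc t)) xor_) (carry≡Σgenerate∧propagate a b t)) )
  , ( trans (∸W-digits a 0) (negDigits-zero a)
    , λ t → trans (∸W-digits a (suc t)) (negDigits-suc a t) )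
  , ( trans (⊛-digits a b 0) (productDigits-zero a b)
    , λ t → trans (⊛-digits a b (suc t)) (productDigits-suc a b t) )
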